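{- Let $\mathcal{A}=(A,f)$ be a computable injection structure, let $C$ be a cohesive set, and let $\mathcal{B}=\prod_C\mathcal{A}$. Then: (a) $\chi(\mathcal{B})=\chi(\mathcal{A})$. (b) $\mathcal{A}$ and $\mathcal{B}$ have the same number of $\omega$-orbits. (c) If $\mathcal{A}$ has bounded character and no infinite orbits, then $\mathcal{A}\cong\mathcal{B}$.
   Context: An injection structure $(A,f)$ is a nonempty set $A$ with a one-to-one total function $f:A\to A$; it is computable if $A\subseteq\omega$ and $f$ are computable. The orbit of $a$ is $\mathcal{O}_f(a)=\{b\in A:\exists n\in\omega\,[f^n(a)=b\vee f^n(b)=a]\}$. An infinite orbit is an $\omega$-orbit if it contains an element not in the range of $f$, and a $Z$-orbit if all its elements are in the range of $f$. The character is $\chi(\mathcal{A})=\{\langle k,n\rangle:k,n\ge1$ and $\mathcal{A}$ has at least $n$ orbits of size $k\}$; $\mathcal{A}$ has bounded character if there is a finite bound on the sizes of its finite orbits. A set $C\subseteq\omega$ is cohesive if it is infinite and for every c.e. set $W$, one of $W\cap C$, $\overline{W}\cap C$ is finite; $X\subseteq^*Y$ means $X\setminus Y$ is finite. The cohesive power $\prod_C\mathcal{A}$ has as domain the partial computable functions $\psi:\omega\to A$ with $C\subseteq^*\mathrm{dom}(\psi)$, modulo $\psi_1=_C\psi_2$ iff $C\subseteq^*\{i:\psi_1(i)\downarrow=\psi_2(i)\downarrow\}$, with $f([\psi])=[f\circ\psi]$. -}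

module Defs where

open import Data.Nat using (ℕ; zero; suc; _<_; _≤_)
open import Data.Fin using (Fin)
open import Data.Vec using (Vec; []; _∷_; lookup)
open import Data.Bool using (Bool; true; false; T; if_then_else_)
open import Data.Product using (Σ; ∃; _×_; _,_; proj₁; proj₂)
open import Data.Sum using (_⊎_; inj₁; inj₂)
open import Relation.Nullary using (¬_)
open import Relation.Binary.PropositionalEquality using (_≡_; refl)
open import Function.Bundles using (_⇔_; Equivalence)

data Code : ℕ → Set where
  zer  : ∀ {n} → Code n
  succ : Code 1
  proj : ∀ {n} → Fin n → Code n
  comp : ∀ {m n} → Code m → Vec (Code n) m → Code n
  prec : ∀ {n} → Code n → Code (suc (suc n)) → Code (suc n)
  mu   : ∀ {n} → Code (suc n) → Code n

mutual
  data Eval : ∀ {n} → Code n → Vec ℕ n → ℕ → Set where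
    e-zer  : ∀ {n} {xs : Vec ℕ n} → Eval zer xs 0
    e-succ : ∀ {x} → Eval succ (x ∷ []) (suc x)
    e-proj : ∀ {n} {xs : Vec ℕ n} (i : Fin n) → Eval (proj i) xs (lookup xs i)
    e-comp : ∀ {m n} {g : Code m} {hs : Vec (Code n) m} {xs : Vec ℕ n}
               {ys : Vec ℕ m} {y : ℕ} →
             EvalAll hs xs ys → Eval g ys y → Eval (comp g hs) xs y
    e-prec0 : ∀ {n} {g : Code n} {h : Code (suc (suc n))} {xs : Vec ℕ n} {y} →
              Eval g xs y → Eval (prec g h) (0 ∷ xs) y
    e-precS : ∀ {n} {g : Code n} {h : Code (suc (suc n))} {xs : Vec ℕ n} {k r y} →
              Eval (prec g h) (k ∷ xs) r → Eval h (k ∷ r ∷ xs) y →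
              Eval (prec g h) (suc k ∷ xs) y
    e-mu   : ∀ {n} {g : Code (suc n)} {xs : Vec ℕ n} {y} →
             Eval g (y ∷ xs) 0 →
             (∀ z → z < y → Σ ℕ λ w → Eval g (z ∷ xs) (suc w)) →
             Eval (mu g) xs y

  data EvalAll : ∀ {m n} → Vec (Code n) m → Vec ℕ n → Vec ℕ m → Set where
    ea-[] : ∀ {n} {xs : Vec ℕ n} → EvalAll [] xs []
    ea-∷  : ∀ {m n} {h : Code n} {hs : Vec (Code n) m} {xs : Vec ℕ n} {y ys} →
            Eval h xs y → EvalAll hs xs ys → EvalAll (h ∷ hs) xs (y ∷ ys)

_↓≡_at_ : Code 1 → ℕ → ℕ → Set
e ↓≡ y at x = Eval e (x ∷ []) y

Dom : Code 1 → ℕ → Set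
Dom e x = Σ ℕ λ y → e ↓≡ y at x

ComputableFun : (ℕ → ℕ) → Set
ComputableFun g = Σ (Code 1) λ e → ∀ x → e ↓≡ g x at x

ComputableSet : (ℕ → Bool) → Set
ComputableSet χ = ComputableFun (λ x → if χ x then 1 else 0)

FiniteSet : (ℕ → Set) → Set
FiniteSet X = Σ ℕ λ N → ∀ i → X i → i < N

InfiniteSet : (ℕ → Set) → Set
InfiniteSet X = ¬ FiniteSet X

_⊆*_ : (ℕ → Set) → (ℕ → Set) → Set
X ⊆* Y = FiniteSet (λ i → X i × ¬ Y i)

-- W_e = dom φ_e ranges over all c.e. sets
Cohesive : (ℕ → Set) → Set
Cohesive C = InfiniteSet C ×
  (∀ (e : Code 1) → FiniteSet (λ i → Dom e i × C i)
                  ⊎ FiniteSet (λ i → ¬ Dom e i × C i))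

record InjStr : Set₁ where
  field
    Carrier : Set
    _≈_     : Carrier → Carrier → Set
    fun     : Carrier → Carrier

module _ (S : InjStr) where
  open InjStr S

  iter : ℕ → Carrier → Carrier
  iter zero a = a
  iter (suc n) a = fun (iter n a)

  SameOrbit : Carrier → Carrier → Set
  SameOrbit a b = Σ ℕ λ n → (iter n a ≈ b) ⊎ (iter n b ≈ a)

  OrbitSize : Carrier → ℕ → Set
  OrbitSize a k = Σ (Fin k → Carrier) λ v →
      (∀ i → SameOrbit a (v i))
    × (∀ i j → v i ≈ v j → i ≡ j)
    × (∀ b → SameOrbit a b → Σ (Fin k) λ i → v i ≈ b)

  FiniteOrbit : Carrier → Set
  FiniteOrbit a = Σ ℕ λ k → OrbitSize a k

  InfiniteOrbit : Carrier → Set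
  InfiniteOrbit a = ¬ FiniteOrbit a

  InRange : Carrier → Set
  InRange a = Σ Carrier λ b → fun b ≈ a

  InωOrbit : Carrier → Set
  InωOrbit a = InfiniteOrbit a × (Σ Carrier λ b → SameOrbit a b × ¬ InRange b)

  AtLeastOrbits : ℕ → ℕ → Set
  AtLeastOrbits k n = Σ (Fin n → Carrier) λ r →
      (∀ i → OrbitSize (r i) k)
    × (∀ i j → SameOrbit (r i) (r j) → i ≡ j)

  χ : ℕ → ℕ → Set
  χ k n = 1 ≤ k × 1 ≤ n × AtLeastOrbits k n

  BoundedCharacter : Set
  BoundedCharacter = Σ ℕ λ m → ∀ a k → OrbitSize a k → k ≤ m

  NoInfiniteOrbits : Set
  NoInfiniteOrbits = ∀ a → ¬ InfiniteOrbit a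

-- Same number of ω-orbits: a bijection between the sets of ω-orbits
-- (ω-orbits = elements lying in ω-orbits, modulo SameOrbit).
SameNumberOfωOrbits : InjStr → InjStr → Set
SameNumberOfωOrbits S T =
  Σ (Σ (InjStr.Carrier S) (InωOrbit S) → Σ (InjStr.Carrier T) (InωOrbit T)) λ F →
      (∀ x y → SameOrbit S (proj₁ x) (proj₁ y) → SameOrbit T (proj₁ (F x)) (proj₁ (F y)))
    × (∀ x y → SameOrbit T (proj₁ (F x)) (proj₁ (F y)) → SameOrbit S (proj₁ x) (proj₁ y))
    × (∀ (z : Σ (InjStr.Carrier T) (InωOrbit T)) → Σ (Σ (InjStr.Carrier S) (InωOrbit S)) λ x → SameOrbit T (proj₁ (F x)) (proj₁ z))

_≅_ : InjStr → InjStr → Set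
S ≅ T = Σ (S.Carrier → T.Carrier) λ F →
      (∀ a b → a S.≈ b → F a T.≈ F b)
    × (∀ a b → F a T.≈ F b → a S.≈ b)
    × (∀ c → Σ S.Carrier λ a → F a T.≈ c)
    × (∀ a → F (S.fun a) T.≈ T.fun (F a))
  where module S = InjStr S
        module T = InjStr T

record CompInjStr : Set where
  field
    inA      : ℕ → Bool
    inA-comp : ComputableSet inA
    f        : Σ ℕ (λ x → T (inA x)) → Σ ℕ (λ x → T (inA x))
    f-inj    : ∀ a b → proj₁ (f a) ≡ proj₁ (f b) → proj₁ a ≡ proj₁ b
    nonempty : Σ ℕ (λ x → T (inA x))
    f-code   : Code 1
    f-comp   : ∀ x (p : T (inA x)) y → f-code ↓≡ y at x ⇔ (y ≡ proj₁ (f (x , p)))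

  A : ℕ → Set
  A x = T (inA x)

  asInjStr : InjStr
  asInjStr = record
    { Carrier = Σ ℕ A
    ; _≈_     = λ a b → proj₁ a ≡ proj₁ b
    ; fun     = f }

module CohesivePower (𝒜 : CompInjStr) (C : ℕ → Set) where
  open CompInjStr 𝒜

  record Elt : Set where
    field
      code   : Code 1
      intoA  : ∀ i y → code ↓≡ y at i → A y
      cdom   : C ⊆* Dom code

  _=C_ : Elt → Elt → Set
  ψ₁ =C ψ₂ = C ⊆* (λ i → Σ ℕ λ y → Elt.code ψ₁ ↓≡ y at i × Elt.code ψ₂ ↓≡ y at i)

  fcode : Code 1 → Code 1
  fcode e = comp f-code (e ∷ [])

  private
    fcode-intoA : ∀ e → (∀ i y → e ↓≡ y at i → A y) →
                  ∀ i y → fcode e ↓≡ y at i → A y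
    fcode-intoA e h i y (e-comp (ea-∷ {y = z} ev ea-[]) ev') =
      subst' (Equivalence.to (f-comp z (h i z ev) y) ev')
      where
        subst' : y ≡ proj₁ (f (z , h i z ev)) → A y
        subst' refl = proj₂ (f (z , h i z ev))

    fcode-dom : ∀ e → (∀ i y → e ↓≡ y at i → A y) →
                ∀ i → Dom e i → Dom (fcode e) i
    fcode-dom e h i (z , ev) =
      proj₁ (f (z , h i z ev)) ,
      e-comp (ea-∷ ev ea-[]) (Equivalence.from (f-comp z (h i z ev) _) refl)

  fB : Elt → Elt
  fB ψ = record
    { code  = fcode (Elt.code ψ)
    ; intoA = fcode-intoA (Elt.code ψ) (Elt.intoA ψ)
    ; cdom  = N , λ i (ci , nd) →
        proj₂ (Elt.cdom ψ) i (ci , λ d → nd (fcode-dom (Elt.code ψ) (Elt.intoA ψ) i d))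
    }
    where N = proj₁ (Elt.cdom ψ)

  ∏ : InjStr
  ∏ = record { Carrier = Elt ; _≈_ = _=C_ ; fun = fB }

CohesivePowerOf : CompInjStr → (ℕ → Set) → InjStr
CohesivePowerOf 𝒜 C = CohesivePower.∏ 𝒜 C

-- Constant functions embed 𝔸 = (A, f) into its cohesive power 𝔹, preserving and reflecting
-- orbits, orbit sizes and membership in the range of f, so 𝔹 has at least the orbits of 𝔸.
-- Conversely, finitely many elements of 𝔹 witnessing some orbits can all be evaluated at one
-- point x of C: each relevant equation f^j ψ = φ has a c.e. agreement set, which by cohesiveness
-- contains almost all or almost none of C, so at a large enough x each of the finitely many
-- equations holds in A exactly when it holds in 𝔹 (a Łoś-style argument). This proves (a), and
-- that 𝔸 has n distinct ω-orbits iff 𝔹 has; as both are countable, these equal counts yield a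
-- bijection between their ω-orbits, proving (b). Under the hypotheses of (c) every element
-- of A has a period dividing m!, where m bounds the orbit sizes; hence so does every element of 𝔹,
-- all orbits are finite, and the bijections between the orbits of each size glue to an isomorphism.
module Submission where

open import Defs
open import Level using (0ℓ)
open import Data.Nat using (ℕ)
open import Data.Fin using (Fin)
open import Data.Product using (Σ; _×_; _,_; proj₁; proj₂)
open import Relation.Binary.PropositionalEquality using (_≡_)
open import Relation.Binary.Structures using (IsEquivalence)
open import Relation.Binary.Bundles using (Setoid)
open import Function.Bundles using (_⇔_; Bijection)
open import Axiom.ExcludedMiddle using (ExcludedMiddle)

module Minimisation where
  open import Data.Nat
  open import Data.Nat.Properties
  open import Data.Product
  open import Data.Sum using (inj₁; inj₂)
  open import Data.Empty using (⊥-elim)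
  open import Relation.Nullary using (¬_; yes; no)
  open import Relation.Unary using (Pred; Decidable)
  open import Relation.Binary.PropositionalEquality
  open import Relation.Binary.Definitions using (tri<; tri≈; tri>)

  Least : Pred ℕ _ → ℕ → Set
  Least P m = P m × (∀ j → j < m → ¬ P j)

  least-witness : ∀ {P : Pred ℕ _} → Decidable P → ∀ n → P n → Σ ℕ (Least P)
  least-witness {P} P? n Pn = search 0 n refl (λ _ ())
    where
    search : ∀ m d → m + d ≡ n → (∀ j → j < m → ¬ P j) → Σ ℕ (Least P)
    search m d m+d≡n below with P? m | d
    ... | yes Pm | _     = m , Pm , below
    ... | no ¬Pm | zero  = ⊥-elim (¬Pm (subst P (trans (sym m+d≡n) (+-identityʳ m)) Pn))
    ... | no ¬Pm | suc d = search (suc m) d (trans (sym (+-suc m d)) m+d≡n) below′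
      where
      below′ : ∀ j → j < suc m → ¬ P j
      below′ j j<1+m with m<1+n⇒m<n∨m≡n j<1+m
      ... | inj₁ j<m  = below j j<m
      ... | inj₂ refl = ¬Pm

  least-unique : ∀ {P : Pred ℕ _} {m m′} → Least P m → Least P m′ → m ≡ m′
  least-unique {m = m} {m′} (Pm , below) (Pm′ , below′) with <-cmp m m′
  ... | tri< m<m′ _ _ = ⊥-elim (below′ m m<m′ Pm)
  ... | tri≈ _ m≡m′ _ = m≡m′
  ... | tri> _ _ m′<m = ⊥-elim (below m′ m′<m Pm′)

module Codes where
  open import Data.Nat
  open import Data.Nat.Properties
  open import Data.Fin using (zero; suc)
  open import Data.Vec using (Vec; []; _∷_)
  open import Data.Product
  open import Data.Empty using (⊥-elim)
  open import Relation.Binary.PropositionalEquality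
  open import Relation.Binary.Definitions using (tri<; tri≈; tri>)

  mutual
    eval-deterministic : ∀ {n} {c : Code n} {xs y y′} → Eval c xs y → Eval c xs y′ → y ≡ y′
    eval-deterministic e-zer        e-zer          = refl
    eval-deterministic e-succ       e-succ         = refl
    eval-deterministic (e-proj _)   (e-proj _)     = refl
    eval-deterministic (e-comp a g) (e-comp a′ g′) with evalAll-deterministic a a′
    ... | refl = eval-deterministic g g′
    eval-deterministic (e-prec0 g)   (e-prec0 g′)    = eval-deterministic g g′
    eval-deterministic (e-precS r h) (e-precS r′ h′) with eval-deterministic r r′
    ... | refl = eval-deterministic h h′
    eval-deterministic (e-mu {y = y} g below) (e-mu {y = y′} g′ below′) with <-cmp y y′
    ... | tri< y<y′ _ _ = ⊥-elim (0≢1+n (eval-deterministic g (proj₂ (below′ y y<y′))))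
    ... | tri≈ _ y≡y′ _ = y≡y′
    ... | tri> _ _ y′<y = ⊥-elim (0≢1+n (eval-deterministic g′ (proj₂ (below y′ y′<y))))

    evalAll-deterministic : ∀ {m n} {hs : Vec (Code n) m} {xs ys ys′} →
                            EvalAll hs xs ys → EvalAll hs xs ys′ → ys ≡ ys′
    evalAll-deterministic ea-[]        ea-[]          = refl
    evalAll-deterministic (ea-∷ e es) (ea-∷ e′ es′) =
      cong₂ _∷_ (eval-deterministic e e′) (evalAll-deterministic es es′)

  const : ∀ {n} → ℕ → Code n
  const zero    = zer
  const (suc v) = comp succ (const v ∷ [])

  eval-const : ∀ {n} v {xs : Vec ℕ n} → Eval (const v) xs v
  eval-const zero    = e-zer
  eval-const (suc v) = e-comp (ea-∷ (eval-const v) ea-[]) e-succ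

  predCode : Code 1
  predCode = prec zer (proj zero)

  eval-pred : ∀ x → predCode ↓≡ pred x at x
  eval-pred zero    = e-prec0 e-zer
  eval-pred (suc x) = e-precS (eval-pred x) (e-proj zero)

  monusCode : Code 2
  monusCode = prec (proj zero) (comp predCode (proj (suc zero) ∷ []))

  eval-monus : ∀ y x → Eval monusCode (y ∷ x ∷ []) (x ∸ y)
  eval-monus zero    x = e-prec0 (e-proj zero)
  eval-monus (suc y) x = subst (Eval monusCode _) (pred[m∸n]≡m∸[1+n] x y)
    (e-precS (eval-monus y x) (e-comp (ea-∷ (e-proj (suc zero)) ea-[]) (eval-pred (x ∸ y))))

  plusCode : Code 2
  plusCode = prec (proj zero) (comp succ (proj (suc zero) ∷ []))

  eval-plus : ∀ y x → Eval plusCode (y ∷ x ∷ []) (y + x)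
  eval-plus zero    x = e-prec0 (e-proj zero)
  eval-plus (suc y) x = e-precS (eval-plus y x) (e-comp (ea-∷ (e-proj (suc zero)) ea-[]) e-succ)

  distance : ℕ → ℕ → ℕ
  distance x y = (x ∸ y) + (y ∸ x)

  distance≡0⇒≡ : ∀ x y → distance x y ≡ 0 → x ≡ y
  distance≡0⇒≡ x y d≡0 =
    ≤-antisym (m∸n≡0⇒m≤n (m+n≡0⇒m≡0 (x ∸ y) d≡0)) (m∸n≡0⇒m≤n (m+n≡0⇒n≡0 (x ∸ y) d≡0))

  distance-self : ∀ x → distance x x ≡ 0
  distance-self x rewrite n∸n≡0 x = refl

  distanceCode : Code 2
  distanceCode = comp plusCode (swapped monusCode ∷ monusCode ∷ [])
    where swapped : Code 2 → Code 2
          swapped c = comp c (proj (suc zero) ∷ proj zero ∷ [])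

  eval-distance : ∀ x y → Eval distanceCode (x ∷ y ∷ []) (distance x y)
  eval-distance x y =
    e-comp (ea-∷ (e-comp (ea-∷ (e-proj _) (ea-∷ (e-proj _) ea-[])) (eval-monus y x))
           (ea-∷ (eval-monus x y) ea-[]))
           (eval-plus (x ∸ y) (y ∸ x))

  isZeroCode : Code 1
  isZeroCode = mu (proj (suc zero))

  isZero-complete : isZeroCode ↓≡ 0 at 0
  isZero-complete = e-mu (e-proj (suc zero)) (λ _ ())

  isZero-sound : ∀ {v} → Dom isZeroCode v → v ≡ 0
  isZero-sound (_ , e-mu (e-proj _) _) = refl

  agreeCode : Code 1 → Code 1 → Code 1
  agreeCode e₁ e₂ = comp isZeroCode (comp distanceCode (e₁ ∷ e₂ ∷ []) ∷ [])

  agree-sound : ∀ e₁ e₂ i → Dom (agreeCode e₁ e₂) i → Σ ℕ λ y → e₁ ↓≡ y at i × e₂ ↓≡ y at i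
  agree-sound e₁ e₂ i
    (_ , e-comp (ea-∷ (e-comp (ea-∷ {y = y₁} ev₁ (ea-∷ {y = y₂} ev₂ ea-[])) evd) ea-[]) z)
    with distance≡0⇒≡ y₁ y₂ (trans (eval-deterministic (eval-distance y₁ y₂) evd) (isZero-sound (_ , z)))
  ... | refl = y₁ , ev₁ , ev₂

  agree-complete : ∀ e₁ e₂ i y → e₁ ↓≡ y at i → e₂ ↓≡ y at i → Dom (agreeCode e₁ e₂) i
  agree-complete e₁ e₂ i y ev₁ ev₂ =
    0 , e-comp (ea-∷ (e-comp (ea-∷ ev₁ (ea-∷ ev₂ ea-[]))
                       (subst (Eval distanceCode _) (distance-self y) (eval-distance y y))) ea-[])
               isZero-complete

module GödelNumbering where
  open import Data.Nat
  open import Data.Nat.Properties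
  open import Data.Fin using (toℕ)
  open import Data.Fin.Properties using (toℕ-injective)
  open import Data.Vec using (Vec; []; _∷_)
  open import Data.Product
  open import Relation.Binary.PropositionalEquality

  -- Cantor's enumeration of ℕ × ℕ, walking each antidiagonal a + b = d from (d , 0) to (0 , d).
  nextPair : ℕ × ℕ → ℕ × ℕ
  nextPair (zero  , b) = suc b , 0
  nextPair (suc a , b) = a , suc b

  unpair : ℕ → ℕ × ℕ
  unpair zero    = 0 , 0
  unpair (suc n) = nextPair (unpair n)

  unpair-onto : ∀ a b → Σ ℕ λ n → unpair n ≡ (a , b)
  unpair-onto a b = enumerate (suc (a + b)) a b ≤-refl
    where
    enumerate : ∀ bound a b → a + b < bound → Σ ℕ λ n → unpair n ≡ (a , b)
    enumerate (suc bound) zero    zero    _  = 0 , refl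
    enumerate (suc bound) (suc a) zero    lt
      with enumerate bound 0 a (subst (_< bound) (+-identityʳ a) (≤-pred lt))
    ... | n , eq = suc n , cong nextPair eq
    enumerate (suc bound) a       (suc b) lt
      with enumerate (suc bound) (suc a) b (subst (_< suc bound) (+-suc a b) lt)
    ... | n , eq = suc n , cong nextPair eq

  -- Opaque, so that Agda reads the arguments of pair off an equation pair a b ≡ pair a′ b′.
  opaque
    pair : ℕ → ℕ → ℕ
    pair a b = proj₁ (unpair-onto a b)

    unpair-pair : ∀ a b → unpair (pair a b) ≡ (a , b)
    unpair-pair a b = proj₂ (unpair-onto a b)

  pair-injective : ∀ {a b a′ b′} → pair a b ≡ pair a′ b′ → a ≡ a′ × b ≡ b′
  pair-injective {a} {b} {a′} {b′} eq
    with trans (sym (unpair-pair a b)) (trans (cong unpair eq) (unpair-pair a′ b′))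
  ... | refl = refl , refl

  tag : ∀ {n} → Code n → ℕ
  tag zer        = 0
  tag succ       = 1
  tag (proj _)   = 2
  tag (comp _ _) = 3
  tag (prec _ _) = 4
  tag (mu _)     = 5

  mutual
    body : ∀ {n} → Code n → ℕ
    body zer             = 0
    body succ            = 0
    body (proj i)        = toℕ i
    body (comp {m} g hs) = pair m (pair (encode g) (encodeAll hs))
    body (prec g h)      = pair (encode g) (encode h)
    body (mu g)          = encode g

    encode : ∀ {n} → Code n → ℕ
    encode c = pair (tag c) (body c)

    encodeAll : ∀ {m n} → Vec (Code n) m → ℕ
    encodeAll []       = 0
    encodeAll (h ∷ hs) = pair (encode h) (encodeAll hs)

  mutual
    encode-injective : ∀ {n} {c d : Code n} → encode c ≡ encode d → c ≡ d
    encode-injective {c = c} {d} eq =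
      shape-injective c d (proj₁ (pair-injective eq)) (proj₂ (pair-injective eq))

    encodeAll-injective : ∀ {m n} {hs hs′ : Vec (Code n) m} → encodeAll hs ≡ encodeAll hs′ → hs ≡ hs′
    encodeAll-injective {hs = []}    {[]}     _  = refl
    encodeAll-injective {hs = _ ∷ _} {_ ∷ _} eq =
      cong₂ _∷_ (encode-injective (proj₁ (pair-injective eq)))
                (encodeAll-injective (proj₂ (pair-injective eq)))

    private
      shape-injective : ∀ {n} (c d : Code n) → tag c ≡ tag d → body c ≡ body d → c ≡ d
      shape-injective zer         zer         _ _ = refl
      shape-injective succ        succ        _ _ = refl
      shape-injective (proj i)    (proj j)    _ b = cong proj (toℕ-injective b)
      shape-injective (comp g hs) (comp g′ hs′) _ b with pair-injective b
      ... | refl , b′ = cong₂ comp (encode-injective (proj₁ (pair-injective b′)))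
                                   (encodeAll-injective (proj₂ (pair-injective b′)))
      shape-injective (prec g h)  (prec g′ h′) _ b =
        cong₂ prec (encode-injective (proj₁ (pair-injective b)))
                   (encode-injective (proj₂ (pair-injective b)))
      shape-injective (mu g)      (mu g′)      _ b = cong mu (encode-injective b)
      shape-injective zer        succ       () _
      shape-injective zer        (proj _)   () _
      shape-injective zer        (comp _ _) () _
      shape-injective zer        (prec _ _) () _
      shape-injective zer        (mu _)     () _
      shape-injective succ       zer        () _
      shape-injective succ       (proj _)   () _
      shape-injective succ       (comp _ _) () _
      shape-injective succ       (prec _ _) () _
      shape-injective succ       (mu _)     () _
      shape-injective (proj _)   zer        () _
      shape-injective (proj _)   succ       () _
      shape-injective (proj _)   (comp _ _) () _
      shape-injective (proj _)   (prec _ _) () _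
      shape-injective (proj _)   (mu _)     () _
      shape-injective (comp _ _) zer        () _
      shape-injective (comp _ _) succ       () _
      shape-injective (comp _ _) (proj _)   () _
      shape-injective (comp _ _) (prec _ _) () _
      shape-injective (comp _ _) (mu _)     () _
      shape-injective (prec _ _) zer        () _
      shape-injective (prec _ _) succ       () _
      shape-injective (prec _ _) (proj _)   () _
      shape-injective (prec _ _) (comp _ _) () _
      shape-injective (prec _ _) (mu _)     () _
      shape-injective (mu _)     zer        () _
      shape-injective (mu _)     succ       () _
      shape-injective (mu _)     (proj _)   () _
      shape-injective (mu _)     (comp _ _) () _
      shape-injective (mu _)     (prec _ _) () _

record Numbering (S : Setoid 0ℓ 0ℓ) : Set where
  open Setoid S
  field
    number           : Carrier → ℕ
    number-injective : ∀ {x y} → number x ≡ number y → x ≈ y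

Distinct : Setoid 0ℓ 0ℓ → ℕ → Set
Distinct S n = Σ (Fin n → Carrier) λ v → ∀ i j → v i ≈ v j → i ≡ j
  where open Setoid S

record IsInjection (S : InjStr) : Set where
  open InjStr S
  field
    isEquivalence : IsEquivalence _≈_
    fun-cong      : ∀ {a b} → a ≈ b → fun a ≈ fun b
    fun-injective : ∀ {a b} → fun a ≈ fun b → a ≈ b

module Orbits (em : ExcludedMiddle 0ℓ) {S : InjStr} (isInjection : IsInjection S) where
  open import Data.Nat
  open import Data.Nat.Properties
  open import Data.Nat.DivMod
  open import Data.Fin using (Fin; toℕ; fromℕ<)
  open import Data.Fin.Properties using (toℕ-injective; toℕ-fromℕ<; toℕ<n; pigeonhole; injective⇒≤)
  open import Data.Product
  open import Data.Sum using (inj₁; inj₂)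
  open import Data.Empty using (⊥-elim)
  open import Relation.Nullary using (¬_; yes; no)
  open import Relation.Binary.PropositionalEquality as ≡ using (_≡_; refl; cong)
  import Relation.Binary.Reasoning.Setoid as SetoidReasoning
  open import Function.Definitions using (Injective)
  open Minimisation

  open InjStr S
  open IsInjection isInjection
  open IsEquivalence isEquivalence public using () renaming (refl to ≈-refl; sym to ≈-sym; trans to ≈-trans)

  setoid : Setoid 0ℓ 0ℓ
  setoid = record { isEquivalence = isEquivalence }

  open SetoidReasoning setoid

  ≡⇒≈ : ∀ {a b} → a ≡ b → a ≈ b
  ≡⇒≈ refl = ≈-refl

  iter-cong : ∀ n {a b} → a ≈ b → iter S n a ≈ iter S n b
  iter-cong zero    a≈b = a≈b
  iter-cong (suc n) a≈b = fun-cong (iter-cong n a≈b)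

  iter-injective : ∀ n {a b} → iter S n a ≈ iter S n b → a ≈ b
  iter-injective zero    e = e
  iter-injective (suc n) e = iter-injective n (fun-injective e)

  iter-+ : ∀ m n a → iter S (m + n) a ≡ iter S m (iter S n a)
  iter-+ zero    n a = refl
  iter-+ (suc m) n a = cong fun (iter-+ m n a)

  iter-comm : ∀ m n a → iter S m (iter S n a) ≡ iter S n (iter S m a)
  iter-comm m n a =
    ≡.trans (≡.sym (iter-+ m n a)) (≡.trans (cong (λ k → iter S k a) (+-comm m n)) (iter-+ n m a))

  iter-cancel : ∀ {j j′ a b} → j ≤ j′ → iter S j a ≈ iter S j′ b → a ≈ iter S (j′ ∸ j) b
  iter-cancel {j} {j′} {a} {b} j≤j′ e = iter-injective j (begin
    iter S j a                    ≈⟨ e ⟩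
    iter S j′ b                   ≡⟨ cong (λ k → iter S k b) (≡.sym (m+[n∸m]≡n j≤j′)) ⟩
    iter S (j + (j′ ∸ j)) b       ≡⟨ iter-+ j (j′ ∸ j) b ⟩
    iter S j (iter S (j′ ∸ j) b)  ∎)

  -- SameOrbit is transitive via the symmetric form "some forward images meet".
  Meet : Carrier → Carrier → Set
  Meet a b = Σ ℕ λ m → Σ ℕ λ n → iter S m a ≈ iter S n b

  sameOrbit⇒meet : ∀ {a b} → SameOrbit S a b → Meet a b
  sameOrbit⇒meet (n , inj₁ e) = n , 0 , e
  sameOrbit⇒meet (n , inj₂ e) = 0 , n , ≈-sym e

  meet⇒sameOrbit : ∀ {a b} → Meet a b → SameOrbit S a b
  meet⇒sameOrbit (m , n , e) with m ≤? n
  ... | yes m≤n = n ∸ m , inj₂ (≈-sym (iter-cancel m≤n e))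
  ... | no m≰n  = m ∸ n , inj₁ (≈-sym (iter-cancel (<⇒≤ (≰⇒> m≰n)) (≈-sym e)))

  ≈⇒sameOrbit : ∀ {a b} → a ≈ b → SameOrbit S a b
  ≈⇒sameOrbit a≈b = 0 , inj₁ a≈b

  sameOrbit-refl : ∀ {a} → SameOrbit S a a
  sameOrbit-refl = ≈⇒sameOrbit ≈-refl

  sameOrbit-sym : ∀ {a b} → SameOrbit S a b → SameOrbit S b a
  sameOrbit-sym (n , inj₁ e) = n , inj₂ e
  sameOrbit-sym (n , inj₂ e) = n , inj₁ e

  sameOrbit-trans : ∀ {a b c} → SameOrbit S a b → SameOrbit S b c → SameOrbit S a c
  sameOrbit-trans {a} {b} {c} ab bc with sameOrbit⇒meet ab | sameOrbit⇒meet bc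
  ... | m , n , e₁ | p , q , e₂ = meet⇒sameOrbit (p + m , n + q , (begin
    iter S (p + m) a        ≡⟨ iter-+ p m a ⟩
    iter S p (iter S m a)   ≈⟨ iter-cong p e₁ ⟩
    iter S p (iter S n b)   ≡⟨ iter-comm p n b ⟩
    iter S n (iter S p b)   ≈⟨ iter-cong n e₂ ⟩
    iter S n (iter S q c)   ≡⟨ ≡.sym (iter-+ n q c) ⟩
    iter S (n + q) c        ∎))

  record IsLeastPeriod (a : Carrier) (p : ℕ) : Set where
    field
      positive : 1 ≤ p
      returns  : iter S p a ≈ a
      least    : ∀ j → 1 ≤ j → j < p → ¬ iter S j a ≈ a

  iter-period-multiple : ∀ {a p} → iter S p a ≈ a → ∀ q → iter S (q * p) a ≈ a
  iter-period-multiple e zero = ≈-refl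
  iter-period-multiple {a} {p} e (suc q) = begin
    iter S (p + q * p) a       ≡⟨ iter-+ p (q * p) a ⟩
    iter S p (iter S (q * p) a) ≈⟨ iter-cong p (iter-period-multiple e q) ⟩
    iter S p a                 ≈⟨ e ⟩
    a                          ∎

  iter-period-mod : ∀ {a} p .{{_ : NonZero p}} → iter S p a ≈ a → ∀ n → iter S n a ≈ iter S (n % p) a
  iter-period-mod {a} p e n = begin
    iter S n a                               ≡⟨ cong (λ k → iter S k a) (m≡m%n+[m/n]*n n p) ⟩
    iter S (n % p + (n / p) * p) a           ≡⟨ iter-+ (n % p) ((n / p) * p) a ⟩
    iter S (n % p) (iter S ((n / p) * p) a)  ≈⟨ iter-cong (n % p) (iter-period-multiple e (n / p)) ⟩
    iter S (n % p) a                         ∎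

  position : ∀ {a b p} → IsLeastPeriod a p → SameOrbit S a b → Σ ℕ λ j → j < p × iter S j a ≈ b
  position {p = p@(suc _)} P (n , inj₁ e) =
    n % p , m%n<n n p , ≈-trans (≈-sym (iter-period-mod p (IsLeastPeriod.returns P) n)) e
  position {a} {b} {p@(suc _)} P (n , inj₂ e) = position P (n * p ∸ n , inj₁ (iter-injective n (begin
    iter S n (iter S (n * p ∸ n) a)  ≡⟨ ≡.sym (iter-+ n (n * p ∸ n) a) ⟩
    iter S (n + (n * p ∸ n)) a       ≡⟨ cong (λ k → iter S k a) (m+[n∸m]≡n (m≤m*n n p)) ⟩
    iter S (n * p) a                 ≈⟨ iter-period-multiple (IsLeastPeriod.returns P) n ⟩
    a                                ≈⟨ ≈-sym e ⟩
    iter S n b                       ∎)))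

  private
    position-unique-≤ : ∀ {a p j j′} → IsLeastPeriod a p → j ≤ j′ → j′ < p →
                        iter S j a ≈ iter S j′ a → j ≡ j′
    position-unique-≤ {a} {p} {j} {j′} P j≤j′ j′<p e with j′ ∸ j in d
    ... | zero  = ≤-antisym j≤j′ (m∸n≡0⇒m≤n d)
    ... | suc _ = ⊥-elim (IsLeastPeriod.least P (j′ ∸ j) (≤-trans (s≤s z≤n) (≤-reflexive (≡.sym d)))
                    (≤-<-trans (m∸n≤m j′ j) j′<p) (≈-sym (iter-cancel j≤j′ e)))

  position-unique : ∀ {a p j j′} → IsLeastPeriod a p → j < p → j′ < p →
                    iter S j a ≈ iter S j′ a → j ≡ j′
  position-unique {j = j} {j′} P j<p j′<p e with ≤-total j j′
  ... | inj₁ j≤j′ = position-unique-≤ P j≤j′ j′<p e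
  ... | inj₂ j′≤j = ≡.sym (position-unique-≤ P j′≤j j<p (≈-sym e))

  leastPeriod⇒orbitSize : ∀ {a p} → IsLeastPeriod a p → OrbitSize S a p
  leastPeriod⇒orbitSize {a} P =
      (λ i → iter S (toℕ i) a)
    , (λ i → toℕ i , inj₁ ≈-refl)
    , (λ i j e → toℕ-injective (position-unique P (toℕ<n i) (toℕ<n j) e))
    , λ b a~b → let j , j<p , e = position P a~b in
                fromℕ< j<p , ≈-trans (≡⇒≈ (cong (λ k → iter S k a) (toℕ-fromℕ< j<p))) e

  private
    reindex : ∀ {a k k′} → OrbitSize S a k → OrbitSize S a k′ → Fin k → Fin k′
    reindex (v , v-in , _) (_ , _ , _ , w-onto) i = proj₁ (w-onto (v i) (v-in i))

    reindex-injective : ∀ {a k k′} (os : OrbitSize S a k) (os′ : OrbitSize S a k′) →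
                        Injective _≡_ _≡_ (reindex os os′)
    reindex-injective (v , v-in , v-inj , _) (w , _ , _ , w-onto) {i} {j} e =
      v-inj i j (≈-trans (≈-sym (proj₂ (w-onto (v i) (v-in i))))
                (≈-trans (≡⇒≈ (cong w e)) (proj₂ (w-onto (v j) (v-in j)))))

  orbitSize-unique : ∀ {a k k′} → OrbitSize S a k → OrbitSize S a k′ → k ≡ k′
  orbitSize-unique os os′ =
    ≤-antisym (injective⇒≤ (reindex-injective os os′)) (injective⇒≤ (reindex-injective os′ os))

  leastPeriod-exists : ∀ {a q} → 1 ≤ q → iter S q a ≈ a → Σ ℕ (IsLeastPeriod a)
  leastPeriod-exists {a} {q} 1≤q e
    with least-witness {P = λ q → 1 ≤ q × iter S q a ≈ a} (λ _ → em) q (1≤q , e)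
  ... | p , (1≤p , eₚ) , below = p , record
    { positive = 1≤p ; returns = eₚ ; least = λ j 1≤j j<p eⱼ → below j j<p (1≤j , eⱼ) }

  -- Among a, f a, …, f^k a two coincide by pigeonhole; their gap is a period.
  orbitSize⇒leastPeriod : ∀ {a k} → OrbitSize S a k → IsLeastPeriod a k
  orbitSize⇒leastPeriod {a} {k} os@(v , _ , _ , v-onto)
    with pigeonhole ≤-refl (λ (j : Fin (suc k)) → proj₁ (v-onto (iter S (toℕ j) a) (toℕ j , inj₁ ≈-refl)))
  ... | i , j , i<j , same = ≡.subst (IsLeastPeriod a) (orbitSize-unique (leastPeriod⇒orbitSize P) os) P
    where
    index : ∀ (j : Fin (suc k)) → v _ ≈ iter S (toℕ j) a
    index j = proj₂ (v-onto (iter S (toℕ j) a) (toℕ j , inj₁ ≈-refl))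
    P : IsLeastPeriod a _
    P = proj₂ (leastPeriod-exists (m<n⇒0<n∸m i<j) (≈-sym (iter-cancel (<⇒≤ i<j)
          (≈-trans (≈-sym (index i)) (≈-trans (≡⇒≈ (cong v same)) (index j))))))

  leastPeriod-transfer : ∀ {a b p} → IsLeastPeriod a p → SameOrbit S a b → IsLeastPeriod b p
  leastPeriod-transfer {a} {b} {p} P a~b with position P a~b
  ... | j , _ , eⱼ = record
    { positive = IsLeastPeriod.positive P
    ; returns  = begin
        iter S p b              ≈⟨ iter-cong p (≈-sym eⱼ) ⟩
        iter S p (iter S j a)   ≡⟨ iter-comm p j a ⟩
        iter S j (iter S p a)   ≈⟨ iter-cong j (IsLeastPeriod.returns P) ⟩
        iter S j a              ≈⟨ eⱼ ⟩
        b                       ∎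
    ; least = λ q 1≤q q<p e → IsLeastPeriod.least P q 1≤q q<p (iter-injective j (begin
        iter S j (iter S q a)   ≡⟨ iter-comm j q a ⟩
        iter S q (iter S j a)   ≈⟨ iter-cong q eⱼ ⟩
        iter S q b              ≈⟨ e ⟩
        b                       ≈⟨ ≈-sym eⱼ ⟩
        iter S j a              ∎))
    }

  orbitSize-transfer : ∀ {a b k} → OrbitSize S a k → SameOrbit S a b → OrbitSize S b k
  orbitSize-transfer os a~b = leastPeriod⇒orbitSize (leastPeriod-transfer (orbitSize⇒leastPeriod os) a~b)

  orbitSize-positive : ∀ {a k} → OrbitSize S a k → 1 ≤ k
  orbitSize-positive os = IsLeastPeriod.positive (orbitSize⇒leastPeriod os)

  finiteOrbit⇒inRange : ∀ {a} → FiniteOrbit S a → InRange S a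
  finiteOrbit⇒inRange (suc p , os) = iter S p _ , IsLeastPeriod.returns (orbitSize⇒leastPeriod os)
  finiteOrbit⇒inRange (zero , os) = ⊥-elim (n≮0 (orbitSize-positive os))

  notInRange-sameOrbit⇒≈ : ∀ {a b} → ¬ InRange S a → ¬ InRange S b → SameOrbit S a b → a ≈ b
  notInRange-sameOrbit⇒≈ _  _  (zero  , inj₁ e) = e
  notInRange-sameOrbit⇒≈ _  ∉b (suc n , inj₁ e) = ⊥-elim (∉b (iter S n _ , e))
  notInRange-sameOrbit⇒≈ _  _  (zero  , inj₂ e) = ≈-sym e
  notInRange-sameOrbit⇒≈ ∉a _  (suc n , inj₂ e) = ⊥-elim (∉a (iter S n _ , e))

  -- The orbits meeting P, each represented by any of its elements satisfying P.
  orbitSetoid : (Carrier → Set) → Setoid 0ℓ 0ℓ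
  orbitSetoid P = record
    { Carrier       = Σ Carrier P
    ; _≈_           = λ x y → SameOrbit S (proj₁ x) (proj₁ y)
    ; isEquivalence = record { refl = sameOrbit-refl ; sym = sameOrbit-sym ; trans = sameOrbit-trans }
    }

  orbitNumbering : (number : Carrier → ℕ) → (∀ {x y} → number x ≡ number y → x ≈ y) →
                   ∀ P → Numbering (orbitSetoid P)
  orbitNumbering number number-injective P = record
    { number = λ x → number (proj₁ x) ; number-injective = λ e → ≈⇒sameOrbit (number-injective e) }

  atLeastOrbits⇒distinct : ∀ {k n} → AtLeastOrbits S k n → Distinct (orbitSetoid λ a → OrbitSize S a k) n
  atLeastOrbits⇒distinct (r , r-size , r-distinct) = (λ i → r i , r-size i) , r-distinct

  distinct⇒atLeastOrbits : ∀ {k n} → Distinct (orbitSetoid λ a → OrbitSize S a k) n → AtLeastOrbits S k n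
  distinct⇒atLeastOrbits (v , v-distinct) = (λ i → proj₁ (v i)) , (λ i → proj₂ (v i)) , v-distinct

module ClassCounting (em : ExcludedMiddle 0ℓ) where
  open import Data.Nat
  open import Data.Nat.Properties
  open import Data.Fin using (Fin; toℕ; fromℕ<)
  open import Data.Fin.Properties using (toℕ-injective; toℕ-fromℕ<; toℕ<n; pigeonhole)
  open import Data.Product
  open import Data.Sum using (inj₁; inj₂)
  open import Data.Empty using (⊥-elim)
  open import Relation.Nullary using (¬_; yes; no)
  open import Relation.Binary.PropositionalEquality as ≡ using (_≡_; refl; cong)
  open import Relation.Binary.Definitions using (tri<; tri≈; tri>)
  open Minimisation

  -- index x counts the classes whose least number is below that of x; this numbers the classes
  -- injectively and without gaps.
  module Index {S : Setoid 0ℓ 0ℓ} (N : Numbering S) where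
    open Setoid S renaming (refl to ≈-refl; sym to ≈-sym; trans to ≈-trans)
    open Numbering N

    InClassOf : Carrier → ℕ → Set
    InClassOf x n = Σ Carrier λ y → x ≈ y × number y ≡ n

    leastNumber : Carrier → ℕ
    leastNumber x = proj₁ (least-witness {P = InClassOf x} (λ _ → em) (number x) (x , ≈-refl , refl))

    private
      leastNumber-least : ∀ x → Least (InClassOf x) (leastNumber x)
      leastNumber-least x = proj₂ (least-witness {P = InClassOf x} (λ _ → em) (number x) (x , ≈-refl , refl))

    leastNumber-cong : ∀ {x x′} → x ≈ x′ → leastNumber x ≡ leastNumber x′
    leastNumber-cong {x} {x′} x≈x′ with leastNumber-least x | leastNumber-least x′
    ... | (y , x≈y , ny) , below | (y′ , x′≈y′ , ny′) , below′ =
      least-unique ((y , x≈y , ny) , below)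
                   ( (y′ , ≈-trans x≈x′ x′≈y′ , ny′)
                   , λ j j< (z , x≈z , nz) → below′ j j< (z , ≈-trans (≈-sym x≈x′) x≈z , nz))

    leastNumber-injective : ∀ {x x′} → leastNumber x ≡ leastNumber x′ → x ≈ x′
    leastNumber-injective {x} {x′} e with leastNumber-least x | leastNumber-least x′
    ... | (y , x≈y , ny) , _ | (y′ , x′≈y′ , ny′) , _ =
      ≈-trans x≈y (≈-trans (number-injective (≡.trans ny (≡.trans e (≡.sym ny′)))) (≈-sym x′≈y′))

    IsLeastNumber : ℕ → Set
    IsLeastNumber n = Σ Carrier λ x → leastNumber x ≡ n

    count : ℕ → ℕ
    count zero = 0
    count (suc n) with em {IsLeastNumber n}
    ... | yes _ = suc (count n)
    ... | no _  = count n

    count-mono : ∀ {m n} → m ≤ n → count m ≤ count n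
    count-mono {m} {n} m≤n with m≤n⇒m<n∨m≡n m≤n
    ... | inj₂ refl = ≤-refl
    ... | inj₁ (s≤s m≤n′) = ≤-trans (count-mono m≤n′) (step _)
      where
      step : ∀ n → count n ≤ count (suc n)
      step n with em {IsLeastNumber n}
      ... | yes _ = n≤1+n _
      ... | no _  = ≤-refl

    count-strict : ∀ {m n} → IsLeastNumber m → m < n → count m < count n
    count-strict {m} {n} isLeast m<n with em {IsLeastNumber m} | count-mono {suc m} {n} m<n
    ... | yes _ | le  = le
    ... | no ¬isLeast | _ = ⊥-elim (¬isLeast isLeast)

    count-down : ∀ n j → count n ≡ suc j → Σ ℕ λ m → IsLeastNumber m × count m ≡ j
    count-down (suc n) j e with em {IsLeastNumber n}
    ... | yes isLeast = n , isLeast , suc-injective e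
    ... | no _ = count-down n j e

    index : Carrier → ℕ
    index x = count (leastNumber x)

    index-cong : ∀ {x x′} → x ≈ x′ → index x ≡ index x′
    index-cong x≈x′ = cong count (leastNumber-cong x≈x′)

    index-injective : ∀ {x x′} → index x ≡ index x′ → x ≈ x′
    index-injective {x} {x′} e with <-cmp (leastNumber x) (leastNumber x′)
    ... | tri< lt _ _ = ⊥-elim (<-irrefl e (count-strict (x , refl) lt))
    ... | tri≈ _ eq _ = leastNumber-injective eq
    ... | tri> _ _ gt = ⊥-elim (<-irrefl (≡.sym e) (count-strict (x′ , refl) gt))

    Indexed : ℕ → Set
    Indexed j = Σ Carrier λ x → index x ≡ j

    indexed-downward : ∀ {i j} → Indexed j → i ≤ j → Indexed i
    indexed-downward {i} {j} h i≤j with m≤n⇒m<n∨m≡n i≤j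
    ... | inj₂ refl = h
    ... | inj₁ i<j with j | h
    ...   | suc j′ | x , e with count-down (leastNumber x) j′ e
    ...     | m , (y , ly) , cm = indexed-downward (y , ≡.trans (cong count ly) cm) (≤-pred i<j)

    indexed⇒distinct : ∀ {j} → Indexed j → Distinct S (suc j)
    indexed⇒distinct {j} h = (λ i → proj₁ (pick i)) , λ i i′ e →
      toℕ-injective (≡.trans (≡.sym (proj₂ (pick i))) (≡.trans (index-cong e) (proj₂ (pick i′))))
      where
      pick : ∀ (i : Fin (suc j)) → Indexed (toℕ i)
      pick i = indexed-downward h (≤-pred (toℕ<n i))

    -- j + 1 pairwise inequivalent elements cannot all have index below j.
    distinct⇒indexed : ∀ {j} → Distinct S (suc j) → Indexed j
    distinct⇒indexed {j} (v , v-distinct) with em {Σ (Fin (suc j)) λ i → j ≤ index (v i)}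
    ... | yes (i , j≤index) = indexed-downward (v i , refl) j≤index
    ... | no none with pigeonhole ≤-refl squeeze
      where
      squeeze : Fin (suc j) → Fin j
      squeeze i = fromℕ< (≰⇒> λ le → none (i , le))
    ...   | i , i′ , i<i′ , collide =
      ⊥-elim (<-irrefl (cong toℕ (v-distinct i i′ (index-injective same-index))) i<i′)
      where
      same-index : index (v i) ≡ index (v i′)
      same-index = ≡.trans (≡.sym (toℕ-fromℕ< (≰⇒> λ le → none (i , le))))
                     (≡.trans (cong toℕ collide) (toℕ-fromℕ< (≰⇒> λ le → none (i′ , le))))

  indexed-transfer : ∀ {S T} (NS : Numbering S) (NT : Numbering T) → (∀ n → Distinct S n → Distinct T n) →
                     ∀ {j} → Index.Indexed NS j → Index.Indexed NT j
  indexed-transfer NS NT S⇒T {j} h = Index.distinct⇒indexed NT (S⇒T (suc j) (Index.indexed⇒distinct NS h))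

  classBijection : ∀ {S T : Setoid 0ℓ 0ℓ} → Numbering S → Numbering T →
                   (∀ n → Distinct S n → Distinct T n) → (∀ n → Distinct T n → Distinct S n) →
                   Bijection S T
  classBijection {S} {T} NS NT S⇒T T⇒S = record
    { to        = to
    ; cong      = to-cong
    ; bijective = to-injective
                , λ z → proj₁ (to-onto z) , λ w≈x → Setoid.trans T (to-cong w≈x) (proj₂ (to-onto z))
    }
    where
    module IS = Index NS
    module IT = Index NT
    open Setoid S using () renaming (Carrier to X; _≈_ to _≈S_)
    open Setoid T using () renaming (_≈_ to _≈T_)

    to : X → Setoid.Carrier T
    to x = proj₁ (indexed-transfer NS NT S⇒T (x , refl))

    index-to : ∀ x → IT.index (to x) ≡ IS.index x
    index-to x = proj₂ (indexed-transfer NS NT S⇒T (x , refl))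

    to-cong : ∀ {x y} → x ≈S y → to x ≈T to y
    to-cong {x} {y} x≈y =
      IT.index-injective (≡.trans (index-to x) (≡.trans (IS.index-cong x≈y) (≡.sym (index-to y))))

    to-injective : ∀ {x y} → to x ≈T to y → x ≈S y
    to-injective {x} {y} e =
      IS.index-injective (≡.trans (≡.sym (index-to x)) (≡.trans (IT.index-cong e) (index-to y)))

    to-onto : ∀ z → Σ X λ x → to x ≈T z
    to-onto z = proj₁ back , IT.index-injective (≡.trans (index-to (proj₁ back)) (proj₂ back))
      where
      back : IS.Indexed (IT.index z)
      back = indexed-transfer NT NS T⇒S (z , refl)

-- Given, for each k, a bijection between the orbits of size k of S and of T, send the canonical
-- point of each orbit of S to the point of T that the bijection assigns to it, and extend along f.
module OrbitGluing (em : ExcludedMiddle 0ℓ) {S T : InjStr}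
  (isInjS : IsInjection S) (isInjT : IsInjection T)
  (base : InjStr.Carrier S → InjStr.Carrier S)
  (base-sameOrbit : ∀ a → SameOrbit S (base a) a)
  (base-canonical : ∀ {a b} → SameOrbit S a b → base a ≡ base b)
  (finiteS : ∀ a → FiniteOrbit S a)
  (finiteT : ∀ t → FiniteOrbit T t)
  (bijection : ∀ k → Bijection (Orbits.orbitSetoid em isInjS (λ a → OrbitSize S a k))
                               (Orbits.orbitSetoid em isInjT (λ t → OrbitSize T t k)))
  where
  open import Relation.Binary.PropositionalEquality as ≡ using (_≡_; refl; cong)
  open import Data.Nat
  open import Data.Nat.Properties
  open import Data.Product
  open import Data.Sum using (_⊎_; inj₁; inj₂)

  module S = InjStr S
  module T = InjStr T
  module OS = Orbits em isInjS
  module OT = Orbits em isInjT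

  size : S.Carrier → ℕ
  size r = proj₁ (finiteS r)

  period : ∀ r → OS.IsLeastPeriod r (size r)
  period r = OS.orbitSize⇒leastPeriod (proj₂ (finiteS r))

  image : S.Carrier → T.Carrier
  image r = proj₁ (Bijection.to (bijection (size r)) (r , proj₂ (finiteS r)))

  imagePeriod : ∀ r → OT.IsLeastPeriod (image r) (size r)
  imagePeriod r = OT.orbitSize⇒leastPeriod (proj₂ (Bijection.to (bijection (size r)) (r , proj₂ (finiteS r))))

  offset : S.Carrier → ℕ
  offset a = proj₁ (OS.position (period (base a)) (base-sameOrbit a))

  offset-spec : ∀ {a r} → base a ≡ r → offset a < size r × iter S (offset a) r S.≈ a
  offset-spec {a} refl = proj₂ (OS.position (period (base a)) (base-sameOrbit a))

  base-idempotent : ∀ a → base (base a) ≡ base a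
  base-idempotent a = base-canonical (base-sameOrbit a)

  glue : S.Carrier → T.Carrier
  glue a = iter T (offset a) (image (base a))

  glue-at : ∀ {a r j} → base a ≡ r → j < size r → iter S j r S.≈ a → glue a T.≈ iter T j (image r)
  glue-at {a} refl j<k e = OT.≡⇒≈ (cong (λ i → iter T i (image (base a)))
    (OS.position-unique (period (base a)) (proj₁ (offset-spec refl)) j<k
                        (OS.≈-trans (proj₂ (offset-spec refl)) (OS.≈-sym e))))

  private
    image-cong : ∀ {k k′} → k ≡ k′ → ∀ {x x′} → SameOrbit S (proj₁ x) (proj₁ x′) →
      SameOrbit T (proj₁ (Bijection.to (bijection k) x)) (proj₁ (Bijection.to (bijection k′) x′))
    image-cong {k} refl = Bijection.cong (bijection k)

    image-injective : ∀ {k k′} → k ≡ k′ → ∀ {x x′} →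
      SameOrbit T (proj₁ (Bijection.to (bijection k) x)) (proj₁ (Bijection.to (bijection k′) x′)) →
      SameOrbit S (proj₁ x) (proj₁ x′)
    image-injective {k} refl = Bijection.injective (bijection k)

  size-image : ∀ {r r′} → SameOrbit T (image r) (image r′) → size r ≡ size r′
  size-image {r} {r′} so = OT.orbitSize-unique
    (OT.orbitSize-transfer (OT.leastPeriod⇒orbitSize (imagePeriod r)) so)
    (OT.leastPeriod⇒orbitSize (imagePeriod r′))

  glue-cong : ∀ {a b} → a S.≈ b → glue a T.≈ glue b
  glue-cong {a} {b} a≈b = OT.≈-sym (glue-at (base-canonical (OS.≈⇒sameOrbit (OS.≈-sym a≈b)))
    (proj₁ (offset-spec refl)) (OS.≈-trans (proj₂ (offset-spec refl)) a≈b))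

  glue-injective : ∀ {a b} → glue a T.≈ glue b → a S.≈ b
  glue-injective {a} {b} e = OS.≈-trans (OS.≈-sym (proj₂ (offset-spec refl))) (OS.≈-trans
    (OS.≡⇒≈ (cong (λ i → iter S i (base a)) same-offset)) (proj₂ (offset-spec same-base)))
    where
    same-orbit : SameOrbit S a b
    same-orbit = OS.sameOrbit-trans (OS.sameOrbit-sym (base-sameOrbit a)) (OS.sameOrbit-trans
      (image-injective (size-image images) images) (base-sameOrbit b))
      where
      images : SameOrbit T (image (base a)) (image (base b))
      images = OT.sameOrbit-trans (offset a , inj₁ OT.≈-refl) (OT.sameOrbit-trans (OT.≈⇒sameOrbit e)
                 (OT.sameOrbit-sym (offset b , inj₁ OT.≈-refl)))
    same-base : base b ≡ base a
    same-base = ≡.sym (base-canonical same-orbit)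
    same-offset : offset a ≡ offset b
    same-offset =
      OT.position-unique (imagePeriod (base a)) (proj₁ (offset-spec refl)) (proj₁ (offset-spec same-base))
        (OT.≈-trans e (glue-at same-base (proj₁ (offset-spec same-base)) (proj₂ (offset-spec same-base))))

  image-onto : ∀ t → Σ S.Carrier λ r → SameOrbit T (image (base r)) t
  image-onto t = r₀ , OT.sameOrbit-trans (image-cong r-size (base-sameOrbit r₀)) r₀↦t
    where
    k : ℕ
    k = proj₁ (finiteT t)
    preimage : Σ (Σ S.Carrier λ a → OrbitSize S a k) λ x → _
    preimage = Bijection.surjective (bijection k) (t , proj₂ (finiteT t))
    r₀ : S.Carrier
    r₀ = proj₁ (proj₁ preimage)
    r₀↦t : SameOrbit T (proj₁ (Bijection.to (bijection k) (proj₁ preimage))) t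
    r₀↦t = proj₂ preimage OS.sameOrbit-refl
    r-size : size (base r₀) ≡ k
    r-size = OS.orbitSize-unique (proj₂ (finiteS (base r₀)))
               (OS.orbitSize-transfer (proj₂ (proj₁ preimage)) (OS.sameOrbit-sym (base-sameOrbit r₀)))

  glue-onto : ∀ t → Σ S.Carrier λ a → glue a T.≈ t
  glue-onto t = iter S j r , OT.≈-trans (glue-at a-base j<k OS.≈-refl) eⱼ
    where
    r₀ r : S.Carrier
    r₀ = proj₁ (image-onto t)
    r = base r₀
    located : Σ ℕ λ j → j < size r × iter T j (image r) T.≈ t
    located = OT.position (imagePeriod r) (proj₂ (image-onto t))
    j : ℕ
    j = proj₁ located
    j<k : j < size r
    j<k = proj₁ (proj₂ located)
    eⱼ : iter T j (image r) T.≈ t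
    eⱼ = proj₂ (proj₂ located)
    a-base : base (iter S j r) ≡ r
    a-base = ≡.trans (≡.sym (base-canonical (j , inj₁ OS.≈-refl))) (base-idempotent r₀)

  base-fun : ∀ a → base (S.fun a) ≡ base a
  base-fun a = ≡.sym (base-canonical (1 , inj₁ OS.≈-refl))

  -- Moving from a to f a raises the offset by one, unless it wraps around to the base.
  glue-commutes : ∀ a → glue (S.fun a) T.≈ T.fun (glue a)
  glue-commutes a = by-cases (m≤n⇒m<n∨m≡n (proj₁ (offset-spec {a} refl)))
    where
    r : S.Carrier
    r = base a
    j : ℕ
    j = offset a
    fⱼ₊₁ : iter S (suc j) r S.≈ S.fun a
    fⱼ₊₁ = IsInjection.fun-cong isInjS (proj₂ (offset-spec refl))
    by-cases : suc j < size r ⊎ suc j ≡ size r → glue (S.fun a) T.≈ T.fun (glue a)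
    by-cases (inj₁ next<k) = glue-at (base-fun a) next<k fⱼ₊₁
    by-cases (inj₂ next≡k) =
      OT.≈-trans (glue-at (base-fun a) (OS.orbitSize-positive (proj₂ (finiteS r))) wraps)
                 (OT.≈-sym (OT.≈-trans (OT.≡⇒≈ (cong (λ i → iter T i (image r)) next≡k))
                                       (OT.IsLeastPeriod.returns (imagePeriod r))))
      where
      wraps : r S.≈ S.fun a
      wraps = OS.≈-trans (OS.≈-sym (OS.IsLeastPeriod.returns (period r)))
                (OS.≈-trans (OS.≡⇒≈ (cong (λ i → iter S i r) (≡.sym next≡k))) fⱼ₊₁)

  -- Checking the components against this signature, phrased with the local S and T, is cheap;
  -- checking them directly against _≅_ makes Agda unfold glue.
  glued-≅ : S ≅ T
  glued-≅ = isomorphism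
    where
    isomorphism : Σ (S.Carrier → T.Carrier) λ F →
        (∀ a b → a S.≈ b → F a T.≈ F b) × (∀ a b → F a T.≈ F b → a S.≈ b)
      × (∀ t → Σ S.Carrier λ a → F a T.≈ t) × (∀ a → F (S.fun a) T.≈ T.fun (F a))
    isomorphism =
      glue , (λ a b → glue-cong {a} {b}) , (λ a b → glue-injective {a} {b}) , glue-onto , glue-commutes

bijection⇒sameNumberOfωOrbits :
  ∀ (em : ExcludedMiddle 0ℓ) {S T} (isInjS : IsInjection S) (isInjT : IsInjection T) →
  Bijection (Orbits.orbitSetoid em isInjS (InωOrbit S)) (Orbits.orbitSetoid em isInjT (InωOrbit T)) →
  SameNumberOfωOrbits S T
bijection⇒sameNumberOfωOrbits em isInjS isInjT F =
  to , (λ x y → cong {x} {y}) , (λ x y → injective {x} {y}) ,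
  λ z → proj₁ (surjective z) , proj₂ (surjective z) (Orbits.sameOrbit-refl em isInjS)
  where open Bijection F

module AlmostInclusion (em : ExcludedMiddle 0ℓ) where
  open import Data.Nat
  open import Data.Nat.Properties
  open import Data.Fin using (Fin; zero; suc)
  open import Data.Product
  open import Data.Sum using (inj₁; inj₂)
  open import Relation.Binary.PropositionalEquality using (refl)
  open import Data.Empty using (⊥-elim)
  open import Relation.Nullary using (¬_; yes; no)
  open import Relation.Unary using (Pred; _∩_)
  open import Axiom.DoubleNegationElimination using (em⇒dne)

  ⊆*-weaken : ∀ {X Y Z : Pred ℕ 0ℓ} → X ⊆* Y → (∀ i → X i → Y i → Z i) → X ⊆* Z
  ⊆*-weaken (N , below) Y⇒Z = N , λ i (xi , ¬zi) → below i (xi , λ yi → ¬zi (Y⇒Z i xi yi))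

  ⊆*-∩ : ∀ {X Y Z : Pred ℕ 0ℓ} → X ⊆* Y → X ⊆* Z → X ⊆* (Y ∩ Z)
  ⊆*-∩ {X} {Y} {Z} (N₁ , below₁) (N₂ , below₂) = N₁ ⊔ N₂ , bound
    where
    bound : ∀ i → X i × ¬ (Y ∩ Z) i → i < N₁ ⊔ N₂
    bound i (xi , ¬yz) with em {Y i}
    ... | yes yi = <-≤-trans (below₂ i (xi , λ zi → ¬yz (yi , zi))) (m≤n⊔m N₁ N₂)
    ... | no ¬yi = <-≤-trans (below₁ i (xi , ¬yi)) (m≤m⊔n N₁ N₂)

  ⊆*-all : ∀ {X : Pred ℕ 0ℓ} {Y : Pred ℕ 0ℓ} → (∀ i → Y i) → X ⊆* Y
  ⊆*-all all = 0 , λ i (_ , ¬yi) → ⊥-elim (¬yi (all i))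

  ⊆*-∀Fin : ∀ {n} {X : Pred ℕ 0ℓ} {Y : Fin n → Pred ℕ 0ℓ} →
            (∀ j → X ⊆* Y j) → X ⊆* (λ i → ∀ j → Y j i)
  ⊆*-∀Fin {zero}  _     = ⊆*-all λ _ ()
  ⊆*-∀Fin {suc n} {Y = Y} each = ⊆*-weaken (⊆*-∩ (each zero) (⊆*-∀Fin (λ j → each (suc j)))) λ where
    i _ (y₀ , ys) zero    → y₀
    i _ (y₀ , ys) (suc j) → ys j

  ⊆*-∀< : ∀ k {X : Pred ℕ 0ℓ} {Y : ℕ → Pred ℕ 0ℓ} → (∀ j → j < k → X ⊆* Y j) →
          X ⊆* (λ i → ∀ j → j < k → Y j i)
  ⊆*-∀< zero    _    = ⊆*-all λ _ _ ()
  ⊆*-∀< (suc k) {Y = Y} each =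
    ⊆*-weaken (⊆*-∩ (each k ≤-refl) (⊆*-∀< k λ j j<k → each j (m<n⇒m<1+n j<k))) extend
    where
    extend : ∀ i → _ → Y k i × (∀ j → j < k → Y j i) → ∀ j → j < suc k → Y j i
    extend i _ (yₖ , ys) j j<1+k with m<1+n⇒m<n∨m≡n j<1+k
    ... | inj₁ j<k  = ys j j<k
    ... | inj₂ refl = yₖ

  ⊆*-⇒ : ∀ {P : Set} {X Y : Pred ℕ 0ℓ} → (P → X ⊆* Y) → X ⊆* (λ i → P → Y i)
  ⊆*-⇒ {P} P⇒ with em {P}
  ... | yes p  = ⊆*-weaken (P⇒ p) λ _ _ y _ → y
  ... | no ¬p  = ⊆*-all λ _ p → ⊥-elim (¬p p)

  ⊆*-point : ∀ {X Y : Pred ℕ 0ℓ} → InfiniteSet X → X ⊆* Y → Σ ℕ (X ∩ Y)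
  ⊆*-point {X} {Y} infinite (N , below) with em {Σ ℕ (X ∩ Y)}
  ... | yes found = found
  ... | no none = ⊥-elim (infinite (N , λ i xi → below i (xi , λ yi → none (i , xi , yi))))

  cohesive-avoid : ∀ {C} → Cohesive C → ∀ e → ¬ C ⊆* Dom e → C ⊆* (λ i → ¬ Dom e i)
  cohesive-avoid {C} (_ , split) e ¬cofinite with split e
  ... | inj₁ (N , below) = N , λ i (ci , ¬¬d) → below i (em⇒dne em ¬¬d , ci)
  ... | inj₂ (N , below) = ⊥-elim (¬cofinite (N , λ i (ci , ¬d) → below i (¬d , ci)))

-- As A and the graph of f are decidable, an f-preimage of the value of e can be searched for.
module PreimageSearch (𝒜 : CompInjStr) where
  open import Data.Nat
  open import Data.Nat.Properties
  open import Data.Fin using (zero; suc)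
  open import Data.Vec using ([]; _∷_)
  open import Data.Bool using (true; false; T; if_then_else_)
  open import Data.Bool.Properties using (T-irrelevant)
  open import Data.Product
  open import Data.Unit using (tt)
  open import Data.Empty using (⊥-elim)
  open import Relation.Binary.PropositionalEquality
  open import Function.Bundles using (Equivalence)
  open Minimisation
  open Codes

  open CompInjStr 𝒜

  Σ-A-≡ : ∀ {a b : Σ ℕ A} → proj₁ a ≡ proj₁ b → a ≡ b
  Σ-A-≡ {a , p} {.a , q} refl = cong (a ,_) (T-irrelevant p q)

  private
    indicator : ℕ → ℕ
    indicator y = if inA y then 1 else 0

    -- f-code is only specified on A, so it is applied to y if y ∈ A and to a fixed element of A otherwise.
    clamp : ℕ → ℕ
    clamp y = if inA y then y else proj₁ nonempty

    clamp∈A : ∀ y → A (clamp y)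
    clamp∈A y with inA y in eq
    ... | true  = subst T (sym eq) tt
    ... | false = proj₂ nonempty

    clamp-A : ∀ {y} → A y → clamp y ≡ y
    clamp-A {y} p with inA y | p
    ... | true | _ = refl

    indicator-A : ∀ {y} → A y → indicator y ≡ 1
    indicator-A {y} p with inA y | p
    ... | true | _ = refl

    indicator-positive⇒A : ∀ y → 1 ∸ indicator y ≡ 0 → A y
    indicator-positive⇒A y e with inA y
    ... | true = tt

    indicatorCode : Code 1
    indicatorCode = proj₁ inA-comp

    clampCode : Code 1
    clampCode = comp (prec (const (proj₁ nonempty)) (proj (suc (suc zero)))) (indicatorCode ∷ proj zero ∷ [])

    eval-clamp : ∀ y → clampCode ↓≡ clamp y at y
    eval-clamp y with inA y | proj₂ inA-comp y
    ... | true  | ev = e-comp (ea-∷ ev (ea-∷ (e-proj zero) ea-[]))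
                         (e-precS (e-prec0 (eval-const _)) (e-proj (suc (suc zero))))
    ... | false | ev = e-comp (ea-∷ ev (ea-∷ (e-proj zero) ea-[])) (e-prec0 (eval-const _))

    fClamp : ℕ → ℕ
    fClamp y = proj₁ (f (clamp y , clamp∈A y))

    fClamp-A : ∀ {y} (p : A y) → fClamp y ≡ proj₁ (f (y , p))
    fClamp-A p = cong (λ a → proj₁ (f a)) (Σ-A-≡ (clamp-A p))

    mismatch : ℕ → ℕ → ℕ
    mismatch y x = distance (fClamp y) x + (1 ∸ indicator y)

    mismatchCode : Code 2
    mismatchCode = comp plusCode
      ( comp distanceCode (comp (comp f-code (clampCode ∷ [])) (proj zero ∷ []) ∷ proj (suc zero) ∷ [])
      ∷ comp monusCode (comp indicatorCode (proj zero ∷ []) ∷ const 1 ∷ [])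
      ∷ [])

    eval-mismatch : ∀ y x → Eval mismatchCode (y ∷ x ∷ []) (mismatch y x)
    eval-mismatch y x = e-comp
      (ea-∷ (e-comp (ea-∷ (e-comp (ea-∷ (e-proj zero) ea-[]) eval-fClamp) (ea-∷ (e-proj (suc zero)) ea-[]))
                    (eval-distance (fClamp y) x))
      (ea-∷ (e-comp (ea-∷ (e-comp (ea-∷ (e-proj zero) ea-[]) (proj₂ inA-comp y)) (ea-∷ (eval-const 1) ea-[]))
                    (eval-monus (indicator y) 1))
      ea-[]))
      (eval-plus _ _)
      where
      eval-fClamp : comp f-code (clampCode ∷ []) ↓≡ fClamp y at y
      eval-fClamp = e-comp (ea-∷ (eval-clamp y) ea-[]) (Equivalence.from (f-comp (clamp y) (clamp∈A y) _) refl)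

    mismatch≡0⇒ : ∀ y x → mismatch y x ≡ 0 → Σ (A y) λ p → proj₁ (f (y , p)) ≡ x
    mismatch≡0⇒ y x e = p , trans (sym (fClamp-A p)) (distance≡0⇒≡ _ _ (m+n≡0⇒m≡0 _ e))
      where
      p : A y
      p = indicator-positive⇒A y (m+n≡0⇒n≡0 (distance (fClamp y) x) e)

    ⇒mismatch≡0 : ∀ y x (p : A y) → proj₁ (f (y , p)) ≡ x → mismatch y x ≡ 0
    ⇒mismatch≡0 y x p refl rewrite indicator-A p | fClamp-A p =
      trans (+-identityʳ _) (distance-self (proj₁ (f (y , p))))

  preimageCode : Code 1 → Code 1
  preimageCode e = comp (mu mismatchCode) (e ∷ [])

  preimage-sound : ∀ e i z → preimageCode e ↓≡ z at i →
                   Σ ℕ λ x → e ↓≡ x at i × Σ (A z) λ p → proj₁ (f (z , p)) ≡ x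
  preimage-sound e i z (e-comp (ea-∷ {y = x} ev ea-[]) (e-mu ev₀ _)) =
    x , ev , mismatch≡0⇒ z x (eval-deterministic (eval-mismatch z x) ev₀)

  preimage-complete : ∀ e i x z → e ↓≡ x at i → (p : A z) → proj₁ (f (z , p)) ≡ x →
                      Dom (preimageCode e) i
  preimage-complete e i x z ev p fz≡x
    with least-witness (λ y → mismatch y x ≟ 0) z (⇒mismatch≡0 z x p fz≡x)
  ... | m , m-hit , below = m , e-comp (ea-∷ ev ea-[])
    (e-mu (subst (Eval mismatchCode _) m-hit (eval-mismatch m x)) (λ j j<m → positive j (below j j<m)))
    where
    positive : ∀ j → mismatch j x ≢ 0 → Σ ℕ λ w → Eval mismatchCode (j ∷ x ∷ []) (suc w)
    positive j ≢0 with mismatch j x in eq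
    ... | zero  = ⊥-elim (≢0 refl)
    ... | suc w = w , subst (Eval mismatchCode _) eq (eval-mismatch j x)

module CohesivePowerTheory
  (em : ExcludedMiddle 0ℓ) (𝒜 : CompInjStr) (C : ℕ → Set) (cohesive : Cohesive C) where
  open import Data.Nat hiding (_≟_)
  open import Data.Nat.Properties hiding (_≟_)
  open import Data.Fin using (_≟_)
  open import Data.Product
  open import Data.Sum using (inj₁; inj₂)
  open import Data.Empty using (⊥-elim)
  open import Relation.Nullary using (¬_)
  open import Relation.Nullary.Decidable using (decidable-stable)
  open import Relation.Unary using (Pred)
  open import Relation.Binary.PropositionalEquality
  open import Function.Bundles using (Equivalence; mk⇔)
  open import Data.Nat.Divisibility using (_∣_; divides; ∣-trans; m∣m*n; m≤n⇒m!∣n!)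
  open import Axiom.DoubleNegationElimination using (em⇒dne)
  open Minimisation
  open Codes
  open AlmostInclusion em
  open GödelNumbering using (encode; encode-injective)
  open PreimageSearch 𝒜
  open ClassCounting em using (classBijection)

  open CompInjStr 𝒜
  open CohesivePower 𝒜 C

  𝔸 : InjStr
  𝔸 = asInjStr

  𝔹 : InjStr
  𝔹 = CohesivePowerOf 𝒜 C

  Point : Set
  Point = Σ ℕ A

  isInjection-𝔸 : IsInjection 𝔸
  isInjection-𝔸 = record
    { isEquivalence = record { refl = refl ; sym = sym ; trans = trans }
    ; fun-cong      = λ e → cong (λ a → proj₁ (f a)) (Σ-A-≡ e)
    ; fun-injective = λ {a} {b} → f-inj a b
    }

  Agree : Elt → Elt → Pred ℕ 0ℓ
  Agree ψ φ i = Σ ℕ λ y → Elt.code ψ ↓≡ y at i × Elt.code φ ↓≡ y at i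

  value : ∀ ψ {i y} → Elt.code ψ ↓≡ y at i → Point
  value ψ {i} {y} ev = y , Elt.intoA ψ i y ev

  agree⁻¹ : ∀ {ψ φ i y y′} → Agree ψ φ i →
            Elt.code ψ ↓≡ y at i → Elt.code φ ↓≡ y′ at i → y ≡ y′
  agree⁻¹ (_ , ψz , φz) ψy φy′ = trans (eval-deterministic ψy ψz) (eval-deterministic φz φy′)

  fB-at : ∀ ψ {i} a → Elt.code ψ ↓≡ proj₁ a at i → Elt.code (fB ψ) ↓≡ proj₁ (f a) at i
  fB-at ψ a ev = e-comp (ea-∷ ev ea-[]) (Equivalence.from (f-comp (proj₁ a) (proj₂ a) _) refl)

  fB-at⁻¹ : ∀ ψ {i z} → Elt.code (fB ψ) ↓≡ z at i →
            Σ ℕ λ y → Σ (Elt.code ψ ↓≡ y at i) λ ev → z ≡ proj₁ (f (value ψ ev))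
  fB-at⁻¹ ψ {i} {z} (e-comp (ea-∷ {y = y} ev ea-[]) ev′) =
    y , ev , Equivalence.to (f-comp y (Elt.intoA ψ i y ev) z) ev′

  iter-at : ∀ n ψ {i} a → Elt.code ψ ↓≡ proj₁ a at i →
            Elt.code (iter 𝔹 n ψ) ↓≡ proj₁ (iter 𝔸 n a) at i
  iter-at zero    ψ a ev = ev
  iter-at (suc n) ψ a ev = fB-at (iter 𝔹 n ψ) (iter 𝔸 n a) (iter-at n ψ a ev)

  =C-refl : ∀ {ψ} → ψ =C ψ
  =C-refl {ψ} = ⊆*-weaken (Elt.cdom ψ) λ _ _ (y , ev) → y , ev , ev

  =C-sym : ∀ {ψ φ} → ψ =C φ → φ =C ψ
  =C-sym ψ=φ = ⊆*-weaken ψ=φ λ _ _ (y , ψy , φy) → y , φy , ψy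

  =C-trans : ∀ {ψ φ χ} → ψ =C φ → φ =C χ → ψ =C χ
  =C-trans {χ = χ} ψ=φ φ=χ = ⊆*-weaken (⊆*-∩ ψ=φ φ=χ) λ i _ ((y , ψy , φy) , (y′ , φy′ , χy′)) →
    y , ψy , subst (λ z → Elt.code χ ↓≡ z at i) (eval-deterministic φy′ φy) χy′

  fB-cong : ∀ {ψ φ} → ψ =C φ → fB ψ =C fB φ
  fB-cong {ψ} {φ} ψ=φ = ⊆*-weaken ψ=φ λ _ _ (y , ψy , φy) →
    let a = value ψ ψy in proj₁ (f a) , fB-at ψ a ψy , fB-at φ a φy

  fB-injective : ∀ {ψ φ} → fB ψ =C fB φ → ψ =C φ
  fB-injective {ψ} {φ} fψ=fφ = ⊆*-weaken fψ=fφ λ i _ (z , fψz , fφz) →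
    let y , ψy , z≡fa = fB-at⁻¹ ψ fψz
        y′ , φy′ , z≡fb = fB-at⁻¹ φ fφz
    in y , ψy , subst (λ w → Elt.code φ ↓≡ w at i)
                      (sym (f-inj (value ψ ψy) (value φ φy′) (trans (sym z≡fa) z≡fb))) φy′

  isInjection-𝔹 : IsInjection 𝔹
  isInjection-𝔹 = record
    { isEquivalence = record
        { refl  = λ {ψ} → =C-refl {ψ}
        ; sym   = λ {ψ} {φ} → =C-sym {ψ} {φ}
        ; trans = λ {ψ} {φ} {χ} → =C-trans {ψ} {φ} {χ}
        }
    ; fun-cong      = λ {ψ} {φ} → fB-cong {ψ} {φ}
    ; fun-injective = λ {ψ} {φ} → fB-injective {ψ} {φ}
    }

  module O𝔸 = Orbits em isInjection-𝔸
  module O𝔹 = Orbits em isInjection-𝔹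

  -- The agreement set of ψ and φ is c.e., so by cohesiveness it contains almost all or almost none of C.
  separate : ∀ {ψ φ} → ¬ ψ =C φ → C ⊆* (λ i → ¬ Agree ψ φ i)
  separate {ψ} {φ} ψ≠φ =
    ⊆*-weaken (cohesive-avoid cohesive (agreeCode (Elt.code ψ) (Elt.code φ)) λ cofinite →
                ψ≠φ (⊆*-weaken cofinite λ i _ → agree-sound _ _ i))
              λ i _ ¬d (y , ψy , φy) → ¬d (agree-complete _ _ i y ψy φy)

  point : ∀ {X : Pred ℕ 0ℓ} → C ⊆* X → Σ ℕ λ i → C i × X i
  point = ⊆*-point (proj₁ cohesive)

  constElt : Point → Elt
  constElt a = record
    { code  = const (proj₁ a)
    ; intoA = λ i y ev → subst A (eval-deterministic (eval-const _) ev) (proj₂ a)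
    ; cdom  = ⊆*-all λ _ → proj₁ a , eval-const _
    }

  const-iter : ∀ n a → iter 𝔹 n (constElt a) =C constElt (iter 𝔸 n a)
  const-iter n a = ⊆*-all λ _ → _ , iter-at n (constElt a) a (eval-const _) , eval-const _

  const-cong : ∀ a b → proj₁ a ≡ proj₁ b → constElt a =C constElt b
  const-cong a b refl = =C-refl {constElt a}

  const-injective : ∀ a b → constElt a =C constElt b → proj₁ a ≡ proj₁ b
  const-injective a b a=b with point a=b
  ... | i , _ , agreement = agree⁻¹ {constElt a} {constElt b} agreement (eval-const _) (eval-const _)

  const-iter-≈ : ∀ n a b → proj₁ (iter 𝔸 n a) ≡ proj₁ b → iter 𝔹 n (constElt a) =C constElt b
  const-iter-≈ n a b e =
    =C-trans {iter 𝔹 n (constElt a)} {constElt (iter 𝔸 n a)} {constElt b}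
             (const-iter n a) (const-cong (iter 𝔸 n a) b e)

  const-iter-≈⁻¹ : ∀ n a b → iter 𝔹 n (constElt a) =C constElt b → proj₁ (iter 𝔸 n a) ≡ proj₁ b
  const-iter-≈⁻¹ n a b e =
    const-injective (iter 𝔸 n a) b (=C-trans {constElt (iter 𝔸 n a)} {iter 𝔹 n (constElt a)} {constElt b}
                                     (=C-sym {iter 𝔹 n (constElt a)} {constElt (iter 𝔸 n a)} (const-iter n a)) e)

  const-sameOrbit : ∀ {a b} → SameOrbit 𝔸 a b → SameOrbit 𝔹 (constElt a) (constElt b)
  const-sameOrbit {a} {b} (n , inj₁ e) = n , inj₁ (const-iter-≈ n a b e)
  const-sameOrbit {a} {b} (n , inj₂ e) = n , inj₂ (const-iter-≈ n b a e)

  const-sameOrbit⁻¹ : ∀ {a b} → SameOrbit 𝔹 (constElt a) (constElt b) → SameOrbit 𝔸 a b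
  const-sameOrbit⁻¹ {a} {b} (n , inj₁ e) = n , inj₁ (const-iter-≈⁻¹ n a b e)
  const-sameOrbit⁻¹ {a} {b} (n , inj₂ e) = n , inj₂ (const-iter-≈⁻¹ n b a e)

  const-leastPeriod : ∀ {a p} → O𝔸.IsLeastPeriod a p → O𝔹.IsLeastPeriod (constElt a) p
  const-leastPeriod {a} {p} P = record
    { positive = positive
    ; returns  = const-iter-≈ p a a returns
    ; least    = λ j 1≤j j<p e → least j 1≤j j<p (const-iter-≈⁻¹ j a a e)
    }
    where open O𝔸.IsLeastPeriod P

  const-leastPeriod⁻¹ : ∀ {a p} → O𝔹.IsLeastPeriod (constElt a) p → O𝔸.IsLeastPeriod a p
  const-leastPeriod⁻¹ {a} {p} P = record
    { positive = positive
    ; returns  = const-iter-≈⁻¹ p a a returns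
    ; least    = λ j 1≤j j<p e → least j 1≤j j<p (const-iter-≈ j a a e)
    }
    where open O𝔹.IsLeastPeriod P

  const-orbitSize : ∀ {a k} → OrbitSize 𝔸 a k → OrbitSize 𝔹 (constElt a) k
  const-orbitSize {a} os = O𝔹.leastPeriod⇒orbitSize (const-leastPeriod (O𝔸.orbitSize⇒leastPeriod {a} os))

  const-notInRange : ∀ {b} → ¬ InRange 𝔸 b → ¬ InRange 𝔹 (constElt b)
  const-notInRange {b} b∉ran (φ , fφ=b) with point fφ=b
  ... | i , _ , z , fφz , bz with fB-at⁻¹ φ fφz
  ... | y , φy , z≡fa = b∉ran (value φ φy , trans (sym z≡fa) (eval-deterministic bz (eval-const _)))

  const-ωOrbit : ∀ {a} → InωOrbit 𝔸 a → InωOrbit 𝔹 (constElt a)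
  const-ωOrbit {a} (infinite , b , a~b , b∉ran) =
      (λ (k , os) → infinite (k , O𝔸.leastPeriod⇒orbitSize
                                    (const-leastPeriod⁻¹ {a} (O𝔹.orbitSize⇒leastPeriod {constElt a} os))))
    , constElt b , const-sameOrbit a~b , const-notInRange {b} b∉ran

  -- Part (a): the character.

  agree-at : ∀ ψ φ {i y z} → Elt.code ψ ↓≡ y at i → Elt.code φ ↓≡ z at i → y ≡ z → Agree ψ φ i
  agree-at ψ φ ψy φz refl = _ , ψy , φz

  atLeastOrbits-𝔸⇒𝔹 : ∀ {k n} → AtLeastOrbits 𝔸 k n → AtLeastOrbits 𝔹 k n
  atLeastOrbits-𝔸⇒𝔹 (r , r-size , r-distinct) =
    (λ i → constElt (r i)) , (λ i → const-orbitSize (r-size i)) ,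
    λ i j so → r-distinct i j (const-sameOrbit⁻¹ so)

  -- Evaluate the ψᵢ at a point x of C where all the finitely many equations deciding the periods of
  -- the ψᵢ and the distinctness of their orbits hold exactly as in 𝔹.
  atLeastOrbits-𝔹⇒𝔸 : ∀ {k n} → AtLeastOrbits 𝔹 k n → AtLeastOrbits 𝔸 k n
  atLeastOrbits-𝔹⇒𝔸 {k} {n} (ψ , ψ-size , ψ-distinct) =
    a , (λ i → O𝔸.leastPeriod⇒orbitSize (a-period i)) , a-distinct
    where
    P : ∀ i → O𝔹.IsLeastPeriod (ψ i) k
    P i = O𝔹.orbitSize⇒leastPeriod {ψ i} (ψ-size i)

    Good : Fin n → Pred ℕ 0ℓ
    Good i x = Agree (iter 𝔹 k (ψ i)) (ψ i) x
             × (∀ j → j < k → 1 ≤ j → ¬ Agree (iter 𝔹 j (ψ i)) (ψ i) x)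
             × (∀ i′ j → j < k → i ≢ i′ → ¬ Agree (iter 𝔹 j (ψ i)) (ψ i′) x)

    good : Σ ℕ λ x → C x × ∀ i → Good i x
    good = point (⊆*-∀Fin λ i →
      ⊆*-∩ (O𝔹.IsLeastPeriod.returns (P i)) (⊆*-∩
        (⊆*-∀< k λ j j<k → ⊆*-⇒ λ 1≤j →
           separate {iter 𝔹 j (ψ i)} {ψ i} (O𝔹.IsLeastPeriod.least (P i) j 1≤j j<k))
        (⊆*-∀Fin λ i′ → ⊆*-∀< k λ j j<k → ⊆*-⇒ λ i≢i′ →
           separate {iter 𝔹 j (ψ i)} {ψ i′} λ e → i≢i′ (ψ-distinct i i′ (j , inj₁ e)))))

    x : ℕ
    x = proj₁ good

    returns-at : ∀ i → Agree (iter 𝔹 k (ψ i)) (ψ i) x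
    returns-at i = proj₁ (proj₂ (proj₂ good) i)

    aperiodic-at : ∀ i j → j < k → 1 ≤ j → ¬ Agree (iter 𝔹 j (ψ i)) (ψ i) x
    aperiodic-at i = proj₁ (proj₂ (proj₂ (proj₂ good) i))

    apart-at : ∀ i i′ j → j < k → i ≢ i′ → ¬ Agree (iter 𝔹 j (ψ i)) (ψ i′) x
    apart-at i = proj₂ (proj₂ (proj₂ (proj₂ good) i))

    value-ψ : ∀ i → Σ ℕ (λ y → Elt.code (ψ i) ↓≡ y at x)
    value-ψ i = let (y , _ , ψy) = returns-at i in y , ψy

    a : Fin n → Point
    a i = value (ψ i) (proj₂ (value-ψ i))

    a-at : ∀ i j → Elt.code (iter 𝔹 j (ψ i)) ↓≡ proj₁ (iter 𝔸 j (a i)) at x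
    a-at i j = iter-at j (ψ i) (a i) (proj₂ (value-ψ i))

    a-period : ∀ i → O𝔸.IsLeastPeriod (a i) k
    a-period i = record
      { positive = O𝔹.IsLeastPeriod.positive (P i)
      ; returns  = agree⁻¹ {iter 𝔹 k (ψ i)} {ψ i} (returns-at i) (a-at i k) (a-at i 0)
      ; least    = λ j 1≤j j<k e →
          aperiodic-at i j j<k 1≤j (agree-at (iter 𝔹 j (ψ i)) (ψ i) (a-at i j) (a-at i 0) e)
      }

    a-distinct : ∀ i i′ → SameOrbit 𝔸 (a i) (a i′) → i ≡ i′
    a-distinct i i′ so = decidable-stable (i ≟ i′) λ i≢i′ →
      let j , j<k , e = O𝔸.position (a-period i) so
      in apart-at i i′ j j<k i≢i′ (agree-at (iter 𝔹 j (ψ i)) (ψ i′) (a-at i j) (a-at i′ 0) e)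

  χ-equal : ∀ k n → χ 𝔹 k n ⇔ χ 𝔸 k n
  χ-equal k n = mk⇔ (λ (1≤k , 1≤n , many) → 1≤k , 1≤n , atLeastOrbits-𝔹⇒𝔸 many)
                    (λ (1≤k , 1≤n , many) → 1≤k , 1≤n , atLeastOrbits-𝔸⇒𝔹 many)

  -- Part (b): ω-orbits.

  preimageElt : ∀ φ → C ⊆* Dom (preimageCode (Elt.code φ)) → Elt
  preimageElt φ cofinite = record
    { code  = preimageCode (Elt.code φ)
    ; intoA = λ i z ev → proj₁ (proj₂ (proj₂ (preimage-sound _ i z ev)))
    ; cdom  = cofinite
    }

  fB-preimageElt : ∀ φ cofinite → fB (preimageElt φ cofinite) =C φ
  fB-preimageElt φ cofinite = ⊆*-weaken cofinite λ i _ (z , ev) →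
    let x , φx , p , fz≡x = preimage-sound _ i z ev
    in x , subst (λ w → Elt.code (fB (preimageElt φ cofinite)) ↓≡ w at i) fz≡x
                 (fB-at (preimageElt φ cofinite) (z , p) ev)
         , φx

  notInRange⇒preimage-rare : ∀ {φ} → ¬ InRange 𝔹 φ → C ⊆* (λ i → ¬ Dom (preimageCode (Elt.code φ)) i)
  notInRange⇒preimage-rare {φ} φ∉ran =
    cohesive-avoid cohesive _ λ cofinite → φ∉ran (preimageElt φ cofinite , fB-preimageElt φ cofinite)

  ωOrbitSetoid𝔸 : Setoid 0ℓ 0ℓ
  ωOrbitSetoid𝔸 = O𝔸.orbitSetoid (InωOrbit 𝔸)

  ωOrbitSetoid𝔹 : Setoid 0ℓ 0ℓ
  ωOrbitSetoid𝔹 = O𝔹.orbitSetoid (InωOrbit 𝔹)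

  distinctωOrbits-𝔸⇒𝔹 : ∀ {n} → Distinct ωOrbitSetoid𝔸 n → Distinct ωOrbitSetoid𝔹 n
  distinctωOrbits-𝔸⇒𝔹 (v , v-distinct) =
    (λ i → constElt (proj₁ (v i)) , const-ωOrbit (proj₂ (v i))) ,
    λ i j so → v-distinct i j (const-sameOrbit⁻¹ so)

  -- Evaluate the elements φᵢ outside the range of f at a point x of C where each φᵢ(x) has no
  -- f-preimage and the φᵢ(x) are pairwise distinct.
  distinctωOrbits-𝔹⇒𝔸 : ∀ {n} → Distinct ωOrbitSetoid𝔹 n → Distinct ωOrbitSetoid𝔸 n
  distinctωOrbits-𝔹⇒𝔸 {n} (v , v-distinct) = (λ i → a i , a-ωOrbit i) , a-distinct
    where
    φ : Fin n → Elt
    φ i = proj₁ (proj₂ (proj₂ (v i)))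

    ψ~φ : ∀ i → SameOrbit 𝔹 (proj₁ (v i)) (φ i)
    ψ~φ i = proj₁ (proj₂ (proj₂ (proj₂ (v i))))

    Good : Fin n → Pred ℕ 0ℓ
    Good i x = Dom (Elt.code (φ i)) x × ¬ Dom (preimageCode (Elt.code (φ i))) x
             × (∀ i′ → i ≢ i′ → ¬ Agree (φ i) (φ i′) x)

    good : Σ ℕ λ x → C x × ∀ i → Good i x
    good = point (⊆*-∀Fin λ i → ⊆*-∩ (Elt.cdom (φ i)) (⊆*-∩
      (notInRange⇒preimage-rare {φ i} (proj₂ (proj₂ (proj₂ (proj₂ (v i))))))
      (⊆*-∀Fin λ i′ → ⊆*-⇒ λ i≢i′ → separate {φ i} {φ i′} λ φ=φ′ → i≢i′ (v-distinct i i′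
        (O𝔹.sameOrbit-trans {proj₁ (v i)} {φ i} {proj₁ (v i′)} (ψ~φ i)
          (O𝔹.sameOrbit-trans {φ i} {φ i′} {proj₁ (v i′)}
            (O𝔹.≈⇒sameOrbit {φ i} {φ i′} φ=φ′) (O𝔹.sameOrbit-sym {proj₁ (v i′)} {φ i′} (ψ~φ i′))))))))

    x : ℕ
    x = proj₁ good

    defined-at : ∀ i → Dom (Elt.code (φ i)) x
    defined-at i = proj₁ (proj₂ (proj₂ good) i)

    no-preimage-at : ∀ i → ¬ Dom (preimageCode (Elt.code (φ i))) x
    no-preimage-at i = proj₁ (proj₂ (proj₂ (proj₂ good) i))

    apart-at : ∀ i i′ → i ≢ i′ → ¬ Agree (φ i) (φ i′) x
    apart-at i = proj₂ (proj₂ (proj₂ (proj₂ good) i))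

    a : Fin n → Point
    a i = value (φ i) (proj₂ (defined-at i))

    a∉ran : ∀ i → ¬ InRange 𝔸 (a i)
    a∉ran i (c , fc≡a) =
      no-preimage-at i (preimage-complete _ x _ (proj₁ c) (proj₂ (defined-at i)) (proj₂ c) fc≡a)

    a-ωOrbit : ∀ i → InωOrbit 𝔸 (a i)
    a-ωOrbit i =
      (λ finite → a∉ran i (O𝔸.finiteOrbit⇒inRange finite)) , a i , O𝔸.sameOrbit-refl , a∉ran i

    a-distinct : ∀ i i′ → SameOrbit 𝔸 (a i) (a i′) → i ≡ i′
    a-distinct i i′ so = decidable-stable (i ≟ i′) λ i≢i′ → apart-at i i′ i≢i′
      (agree-at (φ i) (φ i′) (proj₂ (defined-at i)) (proj₂ (defined-at i′))
                (O𝔸.notInRange-sameOrbit⇒≈ (a∉ran i) (a∉ran i′) so))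

  numbering𝔸 : ∀ P → Numbering (O𝔸.orbitSetoid P)
  numbering𝔸 = O𝔸.orbitNumbering proj₁ (λ e → e)

  code-≡⇒=C : ∀ {ψ φ} → Elt.code ψ ≡ Elt.code φ → ψ =C φ
  code-≡⇒=C {ψ} {φ} refl = =C-refl {ψ}

  numbering𝔹 : ∀ P → Numbering (O𝔹.orbitSetoid P)
  numbering𝔹 = O𝔹.orbitNumbering (λ ψ → encode (Elt.code ψ))
                                 λ {ψ} {φ} e → code-≡⇒=C {ψ} {φ} (encode-injective e)

  ωOrbitBijection : Bijection ωOrbitSetoid𝔸 ωOrbitSetoid𝔹
  ωOrbitBijection =
    classBijection (numbering𝔸 _) (numbering𝔹 _) (λ _ → distinctωOrbits-𝔸⇒𝔹) (λ _ → distinctωOrbits-𝔹⇒𝔸)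

  sameNumberOfωOrbits : SameNumberOfωOrbits 𝔸 𝔹
  sameNumberOfωOrbits = bijection⇒sameNumberOfωOrbits em isInjection-𝔸 isInjection-𝔹 ωOrbitBijection

  -- Part (c): bounded character and no infinite orbits.

  orbitBijection : ∀ k → Bijection (O𝔸.orbitSetoid λ a → OrbitSize 𝔸 a k)
                                   (O𝔹.orbitSetoid λ ψ → OrbitSize 𝔹 ψ k)
  orbitBijection k = classBijection (numbering𝔸 _) (numbering𝔹 _)
    (λ _ d → O𝔹.atLeastOrbits⇒distinct (atLeastOrbits-𝔸⇒𝔹 (O𝔸.distinct⇒atLeastOrbits d)))
    (λ _ d → O𝔸.atLeastOrbits⇒distinct (atLeastOrbits-𝔹⇒𝔸 (O𝔹.distinct⇒atLeastOrbits d)))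

  IndexInOrbitOf : Point → ℕ → Set
  IndexInOrbitOf a n = Σ (A n) λ p → SameOrbit 𝔸 (n , p) a

  leastIndexInOrbit : ∀ a → Σ ℕ (Least (IndexInOrbitOf a))
  leastIndexInOrbit a = least-witness (λ _ → em) (proj₁ a) (proj₂ a , O𝔸.sameOrbit-refl)

  base : Point → Point
  base a = proj₁ (leastIndexInOrbit a) , proj₁ (proj₁ (proj₂ (leastIndexInOrbit a)))

  base-sameOrbit : ∀ a → SameOrbit 𝔸 (base a) a
  base-sameOrbit a = proj₂ (proj₁ (proj₂ (leastIndexInOrbit a)))

  base-canonical : ∀ {a b} → SameOrbit 𝔸 a b → base a ≡ base b
  base-canonical {a} {b} a~b =
    Σ-A-≡ (least-unique (proj₂ (leastIndexInOrbit a)) (in-b (proj₂ (leastIndexInOrbit b))))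
    where
    in-b : ∀ {m} → Least (IndexInOrbitOf b) m → Least (IndexInOrbitOf a) m
    in-b ((p , m~b) , below) = (p , O𝔸.sameOrbit-trans m~b (O𝔸.sameOrbit-sym a~b))
                             , λ j j<m (q , j~a) → below j j<m (q , O𝔸.sameOrbit-trans j~a a~b)

  module _ (bounded : BoundedCharacter 𝔸) (noInfinite : NoInfiniteOrbits 𝔸) where

    finite𝔸 : ∀ a → FiniteOrbit 𝔸 a
    finite𝔸 a = em⇒dne em (noInfinite a)

    -- All orbit sizes are at most m, so m! is a common period.
    commonPeriod : ℕ
    commonPeriod = proj₁ bounded !

    orbitSize∣commonPeriod : ∀ {a k} → OrbitSize 𝔸 a k → k ∣ commonPeriod
    orbitSize∣commonPeriod {a} {zero} os = ⊥-elim (n≮0 (O𝔸.orbitSize-positive {a} os))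
    orbitSize∣commonPeriod {a} {suc k} os = ∣-trans (m∣m*n (k !)) (m≤n⇒m!∣n! (proj₂ bounded a (suc k) os))

    iter-commonPeriod-𝔸 : ∀ a → proj₁ (iter 𝔸 commonPeriod a) ≡ proj₁ a
    iter-commonPeriod-𝔸 a with finite𝔸 a
    ... | k , os with orbitSize∣commonPeriod os
    ... | divides q M≡q*k = trans (cong (λ n → proj₁ (iter 𝔸 n a)) M≡q*k)
      (O𝔸.iter-period-multiple {a} (O𝔸.IsLeastPeriod.returns (O𝔸.orbitSize⇒leastPeriod os)) q)

    iter-commonPeriod-𝔹 : ∀ ψ → iter 𝔹 commonPeriod ψ =C ψ
    iter-commonPeriod-𝔹 ψ = ⊆*-weaken (Elt.cdom ψ) λ i _ (y , ev) →
      y , subst (λ z → Elt.code (iter 𝔹 commonPeriod ψ) ↓≡ z at i) (iter-commonPeriod-𝔸 (value ψ ev))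
                (iter-at commonPeriod ψ (value ψ ev) ev) , ev

    finite𝔹 : ∀ ψ → FiniteOrbit 𝔹 ψ
    finite𝔹 ψ =
      let p , P = O𝔹.leastPeriod-exists {ψ} {commonPeriod} (1≤n! (proj₁ bounded)) (iter-commonPeriod-𝔹 ψ)
      in p , O𝔹.leastPeriod⇒orbitSize {ψ} P

    isomorphic : 𝔸 ≅ 𝔹
    isomorphic = OrbitGluing.glued-≅ em isInjection-𝔸 isInjection-𝔹
      base base-sameOrbit base-canonical finite𝔸 finite𝔹 orbitBijection

mainTheorem7 : ExcludedMiddle 0ℓ →
    (𝒜 : CompInjStr) (C : ℕ → Set) → Cohesive C →
      let A = CompInjStr.asInjStr 𝒜
          B = CohesivePowerOf 𝒜 C
      in ((∀ k n → χ B k n ⇔ χ A k n))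
         × SameNumberOfωOrbits A B
         × (BoundedCharacter A → NoInfiniteOrbits A → A ≅ B)
mainTheorem7 em 𝒜 C cohesive = χ-equal , sameNumberOfωOrbits , isomorphic
  where open CohesivePowerTheory em 𝒜 C cohesive
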